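{- For every $n\geq 2$, $\kappa(BH_n;C_4)=n$.
   Context: The $n$-dimensional balanced hypercube $BH_n$ is the graph with vertex set $\{0,1,2,3\}^n$, vertices written $(a_0,a_1,\dots,a_{n-1})$, in which $(a_0,\dots,a_{n-1})$ is adjacent exactly to the $2n$ vertices $((a_0\pm 1)\bmod 4,a_1,\dots,a_{n-1})$ and, for each $1\le i\le n-1$, $((a_0\pm1)\bmod 4,a_1,\dots,a_{i-1},(a_i+(-1)^{a_0})\bmod 4,a_{i+1},\dots,a_{n-1})$. For a connected graph $G$ and a set $F$ of connected subgraphs of $G$, let $V(F)$ be the union of their vertex sets; $F$ is a subgraph-cut if $G-V(F)$ is disconnected or trivial. For a connected subgraph $H$ of $G$, an $H$-structure-cut is a subgraph-cut each of whose elements is isomorphic to $H$, and $\kappa(G;H)$ is the minimum cardinality of an $H$-structure-cut. $C_4$ is the cycle on four vertices. -}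

module Defs where

open import Data.Nat using (ℕ; zero; suc; _≤_)
open import Data.Fin using (Fin; zero; suc)
open import Data.Vec using (Vec; []; _∷_; _[_]%=_)
open import Data.List using (List; length)
open import Data.List.Relation.Unary.Any using (Any)
open import Data.Product using (Σ; _×_; ∃; ∃-syntax)
open import Data.Sum using (_⊎_)
open import Data.Empty using (⊥)
open import Relation.Nullary using (¬_)
open import Relation.Binary.PropositionalEquality using (_≡_; _≢_)

inc4 : Fin 4 → Fin 4
inc4 zero = suc zero
inc4 (suc zero) = suc (suc zero)
inc4 (suc (suc zero)) = suc (suc (suc zero))
inc4 (suc (suc (suc zero))) = zero

dec4 : Fin 4 → Fin 4
dec4 zero = suc (suc (suc zero))
dec4 (suc zero) = zero
dec4 (suc (suc zero)) = suc zero
dec4 (suc (suc (suc zero))) = suc (suc zero)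

-- x ↦ (x + (-1)^a) mod 4
sgnStep : Fin 4 → Fin 4 → Fin 4
sgnStep zero = inc4
sgnStep (suc zero) = dec4
sgnStep (suc (suc zero)) = inc4
sgnStep (suc (suc (suc zero))) = dec4

Vertex : ℕ → Set
Vertex n = Vec (Fin 4) n

-- Adjacency of BH_n: (a_0 ∷ as) ~ (b_0 ∷ bs) iff b_0 = a_0 ± 1 (mod 4) and
-- either bs = as, or bs is as with its i-th entry (i.e. a_{i+1}) replaced by
-- a_{i+1} + (-1)^{a_0} (mod 4).
Adj : ∀ {n} → Vertex n → Vertex n → Set
Adj [] [] = ⊥
Adj (a ∷ as) (b ∷ bs) =
  (b ≡ inc4 a ⊎ b ≡ dec4 a) × (bs ≡ as ⊎ ∃[ i ] (bs ≡ as [ i ]%= sgnStep a))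

record C4 (n : ℕ) : Set where
  field
    v0 v1 v2 v3 : Vertex n
    e01 : Adj v0 v1
    e12 : Adj v1 v2
    e23 : Adj v2 v3
    e30 : Adj v3 v0
    d01 : v0 ≢ v1
    d02 : v0 ≢ v2
    d03 : v0 ≢ v3
    d12 : v1 ≢ v2
    d13 : v1 ≢ v3
    d23 : v2 ≢ v3

InC4 : ∀ {n} → Vertex n → C4 n → Set
InC4 x c = x ≡ C4.v0 c ⊎ x ≡ C4.v1 c ⊎ x ≡ C4.v2 c ⊎ x ≡ C4.v3 c

InV : ∀ {n} → Vertex n → List (C4 n) → Set
InV x F = Any (InC4 x) F

data Reach {n : ℕ} (F : List (C4 n)) : Vertex n → Vertex n → Set where
  here : ∀ {u} → ¬ InV u F → Reach F u u
  step : ∀ {u v w} → Reach F u v → Adj v w → ¬ InV w F → Reach F u w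

-- F is a subgraph-cut: BH_n - V(F) is disconnected or trivial
-- (trivial read as: at most one vertex remains).
IsSubgraphCut : ∀ {n} → List (C4 n) → Set
IsSubgraphCut {n} F =
  (∃[ u ] ∃[ v ] (¬ InV u F × ¬ InV v F × ¬ Reach F u v))
  ⊎ (∀ (u v : Vertex n) → ¬ InV u F → ¬ InV v F → u ≡ v)

KappaC4 : ℕ → ℕ → Set
KappaC4 n k =
  (Σ (List (C4 n)) λ F → length F ≡ k × IsSubgraphCut F)
  × (∀ (F : List (C4 n)) → IsSubgraphCut F → k ≤ length F)

module Submission where

-- κ(BH_n; C₄) = n for n ≥ 2.  Upper bound (UpperBound): the n 4-cycles
-- through pairs of neighbours of (0, 0…0) isolate that vertex.  Lower bound:
-- twins (a, t), (a+2, t) of BH_n have equal neighbourhoods, so BH_n - V(F) is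
-- governed by the quotient graph H_(n-1) on classes E t / O t, a class being
-- dead when both twins are deleted.  If |F| < n, each parity has at most
-- n-1 dead classes and no edge of H_(n-1) is isolated (CutConfig: the 4(n-1)
-- twins of its other neighbours would lie at most two per 4-cycle).  The core
-- theorem: in H_k, k ≥ 1, with at most k dead classes of each parity, alive
-- classes off isolated edges are connected.  It is proved with uniqueness of
-- isolated classes by induction (module Step, joining the four copies of H_k
-- inside H_(k+1)), the base case k = 1 by evaluation.  Walks of classes lift
-- to BH_n - V(F) (LowerBound), and 4|F| + 2 ≤ 4^n leaves two vertices.

open import Defs
open import Level using (0ℓ)
open import Data.Bool using (Bool; true; false; not; T; _∧_; _∨_)
open import Data.Bool.Properties using (T-∧; T-∨; not-involutive; not-¬) renaming (_≟_ to _≟B_)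
open import Data.Empty using (⊥; ⊥-elim)
open import Data.Fin using (Fin; zero; suc)
open import Data.Fin.Properties using () renaming (_≟_ to _≟F_)
open import Data.List using (List; []; _∷_; length; map; _++_; filter; allFin; cartesianProductWith; concatMap)
open import Data.List.Properties using (length-map; length-++; length-tabulate)
open import Data.List.Membership.Propositional using (_∈_; _∉_; find; lose)
open import Data.List.Membership.Propositional.Properties
  using (∈-map⁺; ∈-map⁻; ∈-allFin; ∈-cartesianProductWith⁺; ∈-++⁺ˡ; ∈-++⁺ʳ; ∈-++⁻; ∈-concatMap⁺; ∈-filter⁺; ∈-filter⁻)
import Data.List.Membership.DecPropositional as DecMembership
open import Data.List.Relation.Binary.Subset.Propositional using (_⊆_)
open import Data.List.Relation.Unary.All as All using (All)
open import Data.List.Relation.Unary.Any as Any using (Any; here; there; _─_; any?)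
open import Data.List.Relation.Unary.Unique.Propositional using (Unique; []; _∷_)
import Data.List.Relation.Unary.Unique.Propositional.Properties as Uniqueₚ
open import Data.Maybe using (Maybe; just; nothing; is-just)
import Data.Maybe.Properties as Maybeₚ
open import Data.Nat using (ℕ; zero; suc; _+_; _*_; _^_; _≤_; _<_; z≤n; s≤s; _≤?_)
open import Data.Nat.Properties
open import Data.Nat.Tactic.RingSolver using (solve-∀)
open import Data.Product using (Σ-syntax; ∃-syntax; _×_; _,_; proj₁; proj₂)
open import Data.Sum using (_⊎_; inj₁; inj₂; [_,_])
open import Data.Unit using (tt)
open import Data.Vec using (Vec; []; _∷_; _[_]%=_; lookup; head; replicate)
import Data.Vec.Properties as Vecₚ
open import Effect.Monad using (RawMonad)
open import Function using (_∘_; id)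
open import Function.Bundles using (Equivalence)
open import Relation.Binary.Definitions using (DecidableEquality)
open import Relation.Binary.PropositionalEquality
  using (_≡_; _≢_; refl; sym; trans; cong; cong₂; subst; subst₂; ≢-sym; module ≡-Reasoning)
open import Relation.Nullary using (¬_; Dec; yes; no; ¬?)
open import Relation.Nullary.Decidable
  using (¬¬-excluded-middle; _⊎-dec_; _×-dec_; isYes; toWitness; fromWitness; toWitnessFalse; fromWitnessFalse)
open import Relation.Nullary.Negation using (¬¬-Monad)

-- Classical reasoning is confined to double-negated conclusions: all
-- connectivity statements below are proved in the form ¬ ¬ P.
open RawMonad (¬¬-Monad {a = 0ℓ}) using (pure; _>>=_)

module _ {A : Set} where

  length-─ : ∀ {x : A} {L} (p : x ∈ L) → suc (length (L ─ p)) ≡ length L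
  length-─ (here _) = refl
  length-─ (there p) = cong suc (length-─ p)

  ∈-─ : ∀ {x y : A} {L} (p : x ∈ L) → y ∈ L → x ≢ y → y ∈ (L ─ p)
  ∈-─ (here refl) (here refl) x≢y = ⊥-elim (x≢y refl)
  ∈-─ (here _) (there q) _ = q
  ∈-─ (there p) (here e) _ = here e
  ∈-─ (there p) (there q) x≢y = there (∈-─ p q x≢y)

  unique-length : ∀ {U L : List A} → Unique U → U ⊆ L → length U ≤ length L
  unique-length [] _ = z≤n
  unique-length (x≢U ∷ u) U⊆L =
    ≤-trans (s≤s (unique-length u λ z∈U →
                    ∈-─ (U⊆L (here refl)) (U⊆L (there z∈U)) (All.lookup x≢U z∈U)))
            (≤-reflexive (length-─ (U⊆L (here refl))))

module _ {A : Set} (_≟_ : DecidableEquality A) where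
  open DecMembership _≟_ using (_∈?_)

  unique-avoid : ∀ {U L : List A} → Unique U → length L < length U → ¬ ¬ (∃[ z ] z ∈ U × z ∉ L)
  unique-avoid {U} {L} u L<U no-miss = <⇒≱ L<U (unique-length u U⊆L)
    where
    U⊆L : U ⊆ L
    U⊆L {z} z∈U with z ∈? L
    ... | yes z∈L = z∈L
    ... | no z∉L = ⊥-elim (no-miss (z , z∈U , z∉L))

  unique-exhausts : ∀ {U L : List A} → Unique U → U ⊆ L → length L ≤ length U → L ⊆ U
  unique-exhausts {U} {L} u U⊆L L≤U {z} z∈L with z ∈? U
  ... | yes z∈U = z∈U
  ... | no z∉U = ⊥-elim (<⇒≱ (s≤s L≤U) (unique-length (All.tabulate (λ z'∈U e → z∉U (subst (_∈ U) (sym e) z'∈U)) ∷ u) z∷U⊆L))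
    where
    z∷U⊆L : z ∷ U ⊆ L
    z∷U⊆L (here refl) = z∈L
    z∷U⊆L (there w∈U) = U⊆L w∈U

inc≢id : ∀ x → inc4 x ≢ x
inc≢id zero ()
inc≢id (suc zero) ()
inc≢id (suc (suc zero)) ()
inc≢id (suc (suc (suc zero))) ()

inc²≢id : ∀ x → inc4 (inc4 x) ≢ x
inc²≢id zero ()
inc²≢id (suc zero) ()
inc²≢id (suc (suc zero)) ()
inc²≢id (suc (suc (suc zero))) ()

dec-inc : ∀ x → dec4 (inc4 x) ≡ x
dec-inc zero = refl
dec-inc (suc zero) = refl
dec-inc (suc (suc zero)) = refl
dec-inc (suc (suc (suc zero))) = refl

inc-dec : ∀ x → inc4 (dec4 x) ≡ x
inc-dec zero = refl
inc-dec (suc zero) = refl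
inc-dec (suc (suc zero)) = refl
inc-dec (suc (suc (suc zero))) = refl

dec≢id : ∀ x → dec4 x ≢ x
dec≢id x e = inc≢id (dec4 x) (trans (inc-dec x) (sym e))

inc≢dec : ∀ x → inc4 x ≢ dec4 x
inc≢dec x e = inc²≢id x (trans (cong inc4 e) (inc-dec x))

inc²≡dec² : ∀ x → inc4 (inc4 x) ≡ dec4 (dec4 x)
inc²≡dec² zero = refl
inc²≡dec² (suc zero) = refl
inc²≡dec² (suc (suc zero)) = refl
inc²≡dec² (suc (suc (suc zero))) = refl

inc³≡dec : ∀ x → inc4 (inc4 (inc4 x)) ≡ dec4 x
inc³≡dec zero = refl
inc³≡dec (suc zero) = refl
inc³≡dec (suc (suc zero)) = refl
inc³≡dec (suc (suc (suc zero))) = refl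

dec²≢id : ∀ x → dec4 (dec4 x) ≢ x
dec²≢id x e = inc²≢id x (trans (inc²≡dec² x) e)

inc²≢dec : ∀ x → inc4 (inc4 x) ≢ dec4 x
inc²≢dec x e = dec≢id x (trans (sym (inc³≡dec x)) (trans (cong inc4 e) (inc-dec x)))

four-positions : ∀ y z → z ≡ y ⊎ z ≡ inc4 y ⊎ z ≡ dec4 y ⊎ z ≡ inc4 (inc4 y)
four-positions zero zero = inj₁ refl
four-positions zero (suc zero) = inj₂ (inj₁ refl)
four-positions zero (suc (suc zero)) = inj₂ (inj₂ (inj₂ refl))
four-positions zero (suc (suc (suc zero))) = inj₂ (inj₂ (inj₁ refl))
four-positions (suc zero) zero = inj₂ (inj₂ (inj₁ refl))
four-positions (suc zero) (suc zero) = inj₁ refl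
four-positions (suc zero) (suc (suc zero)) = inj₂ (inj₁ refl)
four-positions (suc zero) (suc (suc (suc zero))) = inj₂ (inj₂ (inj₂ refl))
four-positions (suc (suc zero)) zero = inj₂ (inj₂ (inj₂ refl))
four-positions (suc (suc zero)) (suc zero) = inj₂ (inj₂ (inj₁ refl))
four-positions (suc (suc zero)) (suc (suc zero)) = inj₁ refl
four-positions (suc (suc zero)) (suc (suc (suc zero))) = inj₂ (inj₁ refl)
four-positions (suc (suc (suc zero))) zero = inj₂ (inj₁ refl)
four-positions (suc (suc (suc zero))) (suc zero) = inj₂ (inj₂ (inj₂ refl))
four-positions (suc (suc (suc zero))) (suc (suc zero)) = inj₂ (inj₂ (inj₁ refl))
four-positions (suc (suc (suc zero))) (suc (suc (suc zero))) = inj₁ refl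

-- Vertices (a, t) of BH_(k+1) with a ∈ {0,2} all
-- have the same neighbourhood as their twin (a+2, t), and likewise for
-- a ∈ {1,3}.  Identifying twins gives the bipartite graph H_k on "classes"
-- E t (even first coordinate) and O s (odd first coordinate), t, s ∈ ℤ₄^k,
-- where E t ~ O s iff s is t or t with one coordinate incremented.
Tail : ℕ → Set
Tail k = Vec (Fin 4) k

_≟T_ : ∀ {k} → DecidableEquality (Tail k)
_≟T_ = Vecₚ.≡-dec _≟F_

_∈T?_ : ∀ {k} (t : Tail k) L → Dec (t ∈ L)
_∈T?_ = DecMembership._∈?_ _≟T_

data Class (k : ℕ) : Set where
  E O : Tail k → Class k

_≟C_ : ∀ {k} → DecidableEquality (Class k)
E t ≟C E t' with t ≟T t'
... | yes refl = yes refl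
... | no t≢t' = no λ { refl → t≢t' refl }
O s ≟C O s' with s ≟T s'
... | yes refl = yes refl
... | no s≢s' = no λ { refl → s≢s' refl }
E _ ≟C O _ = no λ ()
O _ ≟C E _ = no λ ()

_▹_ : ∀ {k} → Tail k → Tail k → Set
t ▹ s = s ≡ t ⊎ ∃[ i ] (s ≡ t [ i ]%= inc4)

HAdj : ∀ {k} → Class k → Class k → Set
HAdj (E t) (O s) = t ▹ s
HAdj (O s) (E t) = t ▹ s
HAdj (E _) (E _) = ⊥
HAdj (O _) (O _) = ⊥

HAdj-sym : ∀ {k} {c d : Class k} → HAdj c d → HAdj d c
HAdj-sym {c = E t} {O s} h = h
HAdj-sym {c = O s} {E t} h = h

-- A move selects which coordinate of the tail is incremented along an
-- edge (nothing: none).  Every class has exactly one neighbour per move.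
Move : ℕ → Set
Move k = Maybe (Fin k)

_≟M_ : ∀ {k} → DecidableEquality (Move k)
_≟M_ = Maybeₚ.≡-dec _≟F_

shift unshift : ∀ {k} → Move k → Tail k → Tail k
shift nothing t = t
shift (just i) t = t [ i ]%= inc4
unshift nothing t = t
unshift (just i) t = t [ i ]%= dec4

unshift-shift : ∀ {k} (a : Move k) t → unshift a (shift a t) ≡ t
unshift-shift nothing t = refl
unshift-shift (just i) t =
  trans (Vecₚ.updateAt-updateAt i t) (Vecₚ.updateAt-id-local i t (dec-inc (lookup t i)))

shift-unshift : ∀ {k} (a : Move k) t → shift a (unshift a t) ≡ t
shift-unshift nothing t = refl
shift-unshift (just i) t =
  trans (Vecₚ.updateAt-updateAt i t) (Vecₚ.updateAt-id-local i t (inc-dec (lookup t i)))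

shift-injective : ∀ {k} (a : Move k) {t t'} → shift a t ≡ shift a t' → t ≡ t'
shift-injective a {t} {t'} e =
  trans (sym (unshift-shift a t)) (trans (cong (unshift a) e) (unshift-shift a t'))

▹⇒shift : ∀ {k} {t s : Tail k} → t ▹ s → ∃[ a ] s ≡ shift a t
▹⇒shift (inj₁ e) = nothing , e
▹⇒shift (inj₂ (i , e)) = just i , e

shift▹ : ∀ {k} (a : Move k) t → t ▹ shift a t
shift▹ nothing t = inj₁ refl
shift▹ (just i) t = inj₂ (i , refl)

▹⇒unshift : ∀ {k} {t s : Tail k} → t ▹ s → ∃[ a ] t ≡ unshift a s
▹⇒unshift p with ▹⇒shift p
... | a , e = a , trans (sym (unshift-shift a _)) (cong (unshift a) (sym e))

unshift▹ : ∀ {k} (a : Move k) s → unshift a s ▹ s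
unshift▹ a s = subst (unshift a s ▹_) (shift-unshift a s) (shift▹ a (unshift a s))

bump : ∀ {k} → Move k → Fin k → Fin 4 → Fin 4
bump nothing j x = x
bump (just i) j x with i ≟F j
... | yes _ = inc4 x
... | no _ = x

lookup-shift : ∀ {k} (a : Move k) t j → lookup (shift a t) j ≡ bump a j (lookup t j)
lookup-shift nothing t j = refl
lookup-shift (just i) t j with i ≟F j
... | yes refl = Vecₚ.lookup∘updateAt i t
... | no i≢j = Vecₚ.lookup∘updateAt′ j i (≢-sym i≢j) t

bump-here : ∀ {k} (j : Fin k) x → bump (just j) j x ≡ inc4 x
bump-here j x with j ≟F j
... | yes _ = refl
... | no j≢j = ⊥-elim (j≢j refl)

bump-elsewhere : ∀ {k} (a : Move k) {j} x → a ≢ just j → bump a j x ≡ x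
bump-elsewhere nothing x _ = refl
bump-elsewhere (just i) {j} x a≢j with i ≟F j
... | yes refl = ⊥-elim (a≢j refl)
... | no _ = refl

lookup-shift-elsewhere : ∀ {k} (a : Move k) t {j} → a ≢ just j → lookup (shift a t) j ≡ lookup t j
lookup-shift-elsewhere a t {j} a≢j = trans (lookup-shift a t j) (bump-elsewhere a _ a≢j)

bump-cases : ∀ {k} (a : Move k) j x → bump a j x ≡ x ⊎ bump a j x ≡ inc4 x
bump-cases nothing j x = inj₁ refl
bump-cases (just i) j x with i ≟F j
... | yes _ = inj₂ refl
... | no _ = inj₁ refl

shift-gap : ∀ {k} {a b : Move k} {t t' : Tail k} {α} →
            shift a t ≡ shift b t' → a ≡ just α → b ≢ just α → lookup t' α ≡ inc4 (lookup t α)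
shift-gap {b = b} {t} {t'} {α} e refl b≢α = begin
  lookup t' α               ≡⟨ sym (bump-elsewhere b _ b≢α) ⟩
  bump b α (lookup t' α)    ≡⟨ sym (lookup-shift b t' α) ⟩
  lookup (shift b t') α     ≡⟨ cong (λ v → lookup v α) (sym e) ⟩
  lookup (shift (just α) t) α ≡⟨ lookup-shift (just α) t α ⟩
  bump (just α) α (lookup t α) ≡⟨ bump-here α _ ⟩
  inc4 (lookup t α)         ∎
  where open ≡-Reasoning

shift-agree : ∀ {k} {a b : Move k} {t t' : Tail k} {j} →
              shift a t ≡ shift b t' → a ≢ just j → b ≢ just j → lookup t j ≡ lookup t' j
shift-agree {a = a} {b} {t} {t'} {j} e a≢j b≢j =
  trans (sym (lookup-shift-elsewhere a t a≢j)) (trans (cong (λ v → lookup v j) e) (lookup-shift-elsewhere b t' b≢j))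

shift-move-injective : ∀ {k} (a b : Move k) t → shift a t ≡ shift b t → a ≡ b
shift-move-injective a b t e with a ≟M b
... | yes a≡b = a≡b
shift-move-injective (just α) b t e | no a≢b =
  ⊥-elim (inc≢id _ (sym (shift-gap e refl (λ b≡α → a≢b (sym b≡α)))))
shift-move-injective nothing nothing t e | no a≢b = ⊥-elim (a≢b refl)
shift-move-injective nothing (just β) t e | no _ =
  ⊥-elim (inc≢id _ (sym (shift-gap {b = nothing} (sym e) refl (λ ()))))

unshift-move-injective : ∀ {k} (a b : Move k) s → unshift a s ≡ unshift b s → a ≡ b
unshift-move-injective a b s e = shift-move-injective a b (unshift a s)
  (trans (shift-unshift a s) (trans (sym (shift-unshift b s)) (cong (shift b) (sym e))))

-- Writing s₁ = shift a t = shift b t' and s₂ = shift c t = shift d t',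
-- a ≢ b forces a ≡ c by comparing coordinates, hence s₁ ≡ s₂.
private
  first-moves-agree : ∀ {k} {a b c d : Move k} {t t' : Tail k} →
    shift a t ≡ shift b t' → shift c t ≡ shift d t' → a ≢ b → a ≡ c
  first-moves-agree {a = just α} {b} {c} {d} {t} {t'} e₁ e₂ a≢b with c ≟M just α
  ... | yes c≡α = sym c≡α
  ... | no c≢α = ⊥-elim (coordinate-α (bump-cases d α (lookup t' α)))
    where
    gap : lookup t' α ≡ inc4 (lookup t α)
    gap = shift-gap e₁ refl (λ b≡α → a≢b (sym b≡α))
    at-α : lookup t α ≡ bump d α (lookup t' α)
    at-α = trans (sym (lookup-shift-elsewhere c t c≢α)) (trans (cong (λ v → lookup v α) e₂) (lookup-shift d t' α))
    -- t α would be t α + 1 or t α + 2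
    coordinate-α : bump d α (lookup t' α) ≡ lookup t' α ⊎ bump d α (lookup t' α) ≡ inc4 (lookup t' α) → ⊥
    coordinate-α (inj₁ d-fixes) = inc≢id _ (sym (trans at-α (trans d-fixes gap)))
    coordinate-α (inj₂ d-moves) = inc²≢id _ (sym (trans at-α (trans d-moves (cong inc4 gap))))
  first-moves-agree {a = nothing} {nothing} e₁ e₂ a≢b = ⊥-elim (a≢b refl)
  first-moves-agree {a = nothing} {just β} {nothing} e₁ e₂ a≢b = refl
  first-moves-agree {a = nothing} {just β} {just γ} {d} {t} {t'} e₁ e₂ a≢b = ⊥-elim (contradict (γ ≟F β))
    where
    -- here t β = t' β + 1 and t' γ = t γ + 1, impossible both for γ ≡ β and for γ ≢ β
    gap-β : lookup t β ≡ inc4 (lookup t' β)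
    gap-β = shift-gap {b = nothing} (sym e₁) refl (λ ())
    c≢d : just γ ≢ d
    c≢d refl = a≢b (shift-move-injective nothing (just β) t (trans e₁ (cong (shift (just β)) (sym (shift-injective (just γ) e₂)))))
    gap-γ : lookup t' γ ≡ inc4 (lookup t γ)
    gap-γ = shift-gap e₂ refl (λ d≡γ → c≢d (sym d≡γ))
    contradict : Dec (γ ≡ β) → ⊥
    contradict (yes refl) = inc²≢id _ (sym (trans gap-β (cong inc4 gap-γ)))
    contradict (no γ≢β) =
      inc≢id _ (sym (trans (shift-agree {a = nothing} e₁ (λ ()) (λ β≡γ → γ≢β (sym (Maybeₚ.just-injective β≡γ)))) gap-γ))

girth : ∀ {k} {t t' s₁ s₂ : Tail k} → t ▹ s₁ → t ▹ s₂ → t' ▹ s₁ → t' ▹ s₂ → s₁ ≢ s₂ → t ≡ t'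
girth {t = t} p₁ p₂ q₁ q₂ s₁≢s₂ with ▹⇒shift p₁ | ▹⇒shift p₂ | ▹⇒shift q₁ | ▹⇒shift q₂
... | a , e₁ | c , e₂ | b , e₃ | d , e₄ with a ≟M b
...   | yes refl = shift-injective a (trans (sym e₁) e₃)
...   | no a≢b = ⊥-elim (s₁≢s₂ (trans e₁ (trans (cong (λ m → shift m t) a≡c) (sym e₂))))
  where
  a≡c : a ≡ c
  a≡c = first-moves-agree {c = c} {d} (trans (sym e₁) e₃) (trans (sym e₂) e₄) a≢b

girth-odd : ∀ {k} {t₁ t₂ s s' : Tail k} → t₁ ▹ s → t₂ ▹ s → t₁ ▹ s' → t₂ ▹ s' → t₁ ≢ t₂ → s ≡ s'
girth-odd {s = s} {s'} p₁ p₂ q₁ q₂ t₁≢t₂ with s ≟T s'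
... | yes s≡s' = s≡s'
... | no s≢s' = ⊥-elim (t₁≢t₂ (girth p₁ q₁ p₂ q₂ s≢s'))

moves : ∀ k → List (Move k)
moves k = nothing ∷ map just (allFin k)

moves-complete : ∀ {k} (a : Move k) → a ∈ moves k
moves-complete nothing = here refl
moves-complete (just i) = there (∈-map⁺ just (∈-allFin i))

moves-unique : ∀ k → Unique (moves k)
moves-unique k = All.tabulate nothing∉ ∷ Uniqueₚ.map⁺ Maybeₚ.just-injective (Uniqueₚ.allFin⁺ k)
  where
  nothing∉ : ∀ {a} → a ∈ map just (allFin k) → nothing ≢ a
  nothing∉ a∈ nothing≡a with ∈-map⁻ just a∈
  ... | i , _ , a≡just = case-absurd (trans nothing≡a a≡just)
    where
    case-absurd : nothing ≢ just i
    case-absurd ()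

length-moves : ∀ k → length (moves k) ≡ suc k
length-moves k = cong suc (trans (length-map just (allFin k)) (length-tabulate id))

module _ {A : Set} {k} (f : Move k → A) (f-injective : ∀ {a b} → f a ≡ f b → a ≡ b) where

  count-moves : ∀ (L : List A) → (∀ a → f a ∈ L) → suc k ≤ length L
  count-moves L all∈ = subst (_≤ length L) (trans (length-map f (moves k)) (length-moves k))
    (unique-length (Uniqueₚ.map⁺ f-injective (moves-unique k)) image⊆)
    where
    image⊆ : map f (moves k) ⊆ L
    image⊆ y∈ with ∈-map⁻ f y∈
    ... | a , _ , refl = all∈ a

  count-moves-but-one : ∀ (L : List A) (a₀ : Move k) → (∀ a → a ≢ a₀ → f a ∈ L) → k ≤ length L
  count-moves-but-one L a₀ others∈ = ≤-pred (count-moves (f a₀ ∷ L) all∈)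
    where
    all∈ : ∀ a → f a ∈ f a₀ ∷ L
    all∈ a with a ≟M a₀
    ... | yes refl = here refl
    ... | no a≢a₀ = there (others∈ a a≢a₀)

tailOf : ∀ {k} → Class k → Tail k
tailOf (E t) = t
tailOf (O s) = s

opposite : ∀ {k} → Class k → Tail k → Class k
opposite (E _) = O
opposite (O _) = E

nbrTail : ∀ {k} → Class k → Move k → Tail k
nbrTail (E t) a = shift a t
nbrTail (O s) a = unshift a s

nbr : ∀ {k} → Class k → Move k → Class k
nbr c a = opposite c (nbrTail c a)

nbr-adj : ∀ {k} (c : Class k) a → HAdj c (nbr c a)
nbr-adj (E t) a = shift▹ a t
nbr-adj (O s) a = unshift▹ a s

adj-nbr : ∀ {k} {c d : Class k} → HAdj c d → ∃[ a ] d ≡ nbr c a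
adj-nbr {c = E t} {O s} h with ▹⇒shift h
... | a , e = a , cong O e
adj-nbr {c = O s} {E t} h with ▹⇒unshift h
... | a , e = a , cong E e

nbrTail-injective : ∀ {k} (c : Class k) {a b} → nbrTail c a ≡ nbrTail c b → a ≡ b
nbrTail-injective (E t) = shift-move-injective _ _ t
nbrTail-injective (O s) = unshift-move-injective _ _ s

nbr-injective : ∀ {k} (c : Class k) {a b} → nbr c a ≡ nbr c b → a ≡ b
nbr-injective (E t) e = nbrTail-injective (E t) (cong tailOf e)
nbr-injective (O s) e = nbrTail-injective (O s) (cong tailOf e)

-- A configuration of H_k: the lists of tails of dead even and dead odd
-- classes.  (A class of BH_n is dead when both its twins are deleted.)
record Config (k : ℕ) : Set where
  constructor config
  field
    deadE deadO : List (Tail k)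
open Config

Dead : ∀ {k} → Config k → Class k → Set
Dead cf (E t) = t ∈ deadE cf
Dead cf (O s) = s ∈ deadO cf

Alive : ∀ {k} → Config k → Class k → Set
Alive cf c = ¬ Dead cf c

dead? : ∀ {k} (cf : Config k) c → Dec (Dead cf c)
dead? cf (E t) = t ∈T? deadE cf
dead? cf (O s) = s ∈T? deadO cf

not-alive : ∀ {k} (cf : Config k) c → ¬ Alive cf c → Dead cf c
not-alive cf c ¬alive with dead? cf c
... | yes dead = dead
... | no alive = ⊥-elim (¬alive alive)

deadOpposite : ∀ {k} → Config k → Class k → List (Tail k)
deadOpposite cf (E _) = deadO cf
deadOpposite cf (O _) = deadE cf

dead-nbr : ∀ {k} {cf : Config k} c {a} → Dead cf (nbr c a) → nbrTail c a ∈ deadOpposite cf c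
dead-nbr (E t) d = d
dead-nbr (O s) d = d

Bounded : ∀ {k} → ℕ → Config k → Set
Bounded b cf = length (deadE cf) ≤ b × length (deadO cf) ≤ b

data Walk {k} (cf : Config k) : Class k → Class k → Set where
  start : ∀ {c} → Alive cf c → Walk cf c c
  step : ∀ {a b c} → Walk cf a b → HAdj b c → Alive cf c → Walk cf a c

module _ {k} {cf : Config k} where

  walk-end-alive : ∀ {a b} → Walk cf a b → Alive cf b
  walk-end-alive (start alive) = alive
  walk-end-alive (step _ _ alive) = alive

  walk-trans : ∀ {a b c} → Walk cf a b → Walk cf b c → Walk cf a c
  walk-trans p (start _) = p
  walk-trans p (step q h alive) = step (walk-trans p q) h alive

  walk-edge : ∀ {a b} → Alive cf a → HAdj a b → Alive cf b → Walk cf a b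
  walk-edge alive h alive' = step (start alive) h alive'

  walk-sym : ∀ {a b} → Walk cf a b → Walk cf b a
  walk-sym (start alive) = start alive
  walk-sym (step p h alive) = walk-trans (walk-edge alive (HAdj-sym h) (walk-end-alive p)) (walk-sym p)

-- c lies on an isolated edge c — d: d is alive and every other neighbour
-- of c or of d is dead.  Such edges are the obstruction to connectivity.
Isolated : ∀ {k} → Config k → Class k → Set
Isolated {k} cf c = Σ[ d ∈ Class k ] HAdj c d × Alive cf d ×
  (∀ e → HAdj c e → e ≢ d → Dead cf e) × (∀ e → HAdj d e → e ≢ c → Dead cf e)

two-neighbours-not-isolated : ∀ {k} {cf : Config k} {c d d'} → HAdj c d → Alive cf d →
  HAdj c d' → Alive cf d' → d ≢ d' → ¬ Isolated cf c
two-neighbours-not-isolated {d = d} {d'} h alive h' alive' d≢d' (p , _ , _ , others-dead , _) with d ≟C p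
... | yes refl = alive' (others-dead d' h' (≢-sym d≢d'))
... | no d≢p = alive (others-dead d h d≢p)

module _ {k} {cf : Config k} where

  dead-but-one : ∀ c {d} → HAdj c d → (∀ e → HAdj c e → e ≢ d → Dead cf e) → k ≤ length (deadOpposite cf c)
  dead-but-one c h others-dead with adj-nbr h
  ... | a₀ , refl = count-moves-but-one (nbrTail c) (nbrTail-injective c) _ a₀
    λ a a≢a₀ → dead-nbr c (others-dead (nbr c a) (nbr-adj c a) (λ e → a≢a₀ (nbr-injective c e)))

  all-neighbours-dead : ∀ c → (∀ e → HAdj c e → Dead cf e) → suc k ≤ length (deadOpposite cf c)
  all-neighbours-dead c all-dead =
    count-moves (nbrTail c) (nbrTail-injective c) _ λ a → dead-nbr c (all-dead (nbr c a) (nbr-adj c a))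

  isolated-heavy : ∀ {c} → Isolated cf c → k ≤ length (deadE cf) × k ≤ length (deadO cf)
  isolated-heavy {E t} (O s , h , _ , dead-c , dead-d) =
    dead-but-one (O s) (HAdj-sym {c = E t} {O s} h) dead-d , dead-but-one (E t) h dead-c
  isolated-heavy {O s} (E t , h , _ , dead-c , dead-d) =
    dead-but-one (O s) h dead-c , dead-but-one (E t) (HAdj-sym {c = O s} {E t} h) dead-d

common-neighbours : ∀ {k} {c c' d₁ d₂ : Class k} →
  HAdj c d₁ → HAdj c d₂ → HAdj c' d₁ → HAdj c' d₂ → d₁ ≢ d₂ → c ≡ c'
common-neighbours {c = E t} {E t'} {O s₁} {O s₂} p₁ p₂ q₁ q₂ d₁≢d₂ =
  cong E (girth p₁ p₂ q₁ q₂ (λ e → d₁≢d₂ (cong O e)))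
common-neighbours {c = O s} {O s'} {E t₁} {E t₂} p₁ p₂ q₁ q₂ d₁≢d₂ =
  cong O (girth-odd p₁ p₂ q₁ q₂ (λ e → d₁≢d₂ (cong E e)))
common-neighbours {c = E _} {_} {E _} ()
common-neighbours {c = E _} {_} {O _} {E _} _ ()
common-neighbours {c = E _} {O _} {O _} {O _} _ _ ()
common-neighbours {c = O _} {_} {O _} ()
common-neighbours {c = O _} {_} {E _} {O _} _ ()
common-neighbours {c = O _} {E _} {E _} {E _} _ _ ()

data SameParity {k} : Class k → Class k → Set where
  even : ∀ {t t'} → SameParity (E t) (E t')
  odd : ∀ {s s'} → SameParity (O s) (O s')

two-other-moves : ∀ {k} → 2 ≤ k → (b : Move k) → Σ[ x ∈ Move k ] Σ[ y ∈ Move k ] x ≢ b × y ≢ b × x ≢ y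
two-other-moves (s≤s (s≤s z≤n)) nothing = just zero , just (suc zero) , (λ ()) , (λ ()) , λ ()
two-other-moves (s≤s (s≤s z≤n)) (just zero) = nothing , just (suc zero) , (λ ()) , (λ ()) , λ ()
two-other-moves (s≤s (s≤s z≤n)) (just (suc i)) = nothing , just zero , (λ ()) , (λ ()) , λ ()

-- For k ≥ 2 and at most k dead classes of the opposite parity, at most
-- one class of each parity is isolated: all dead classes of the opposite
-- parity are then neighbours of the isolated class c, and an isolated c'
-- of the same parity has at least two of them as neighbours.
isolated-unique : ∀ {k} {cf : Config k} {c c'} → 2 ≤ k → SameParity c c' →
  length (deadOpposite cf c) ≤ k → Isolated cf c → Isolated cf c' → c ≡ c'
isolated-unique {k} {cf} {c} {c'} 2≤k same few (d , h , _ , dead-c , _) (d' , h' , _ , dead-c' , _)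
  with adj-nbr h | adj-nbr h' | two-other-moves 2≤k (proj₁ (adj-nbr h'))
... | a₀ , refl | b₀ , refl | x , y , x≢b₀ , y≢b₀ , x≢y =
  common-neighbours (towards x x≢b₀) (towards y y≢b₀) (nbr-adj c' x) (nbr-adj c' y) (λ e → x≢y (nbr-injective c' e))
  where
  U : List (Tail k)
  U = map (nbrTail c) (moves k)
  U⊆ : U ⊆ nbrTail c a₀ ∷ deadOpposite cf c
  U⊆ t∈U with ∈-map⁻ (nbrTail c) t∈U
  ... | a , _ , refl with a ≟M a₀
  ...   | yes refl = here refl
  ...   | no a≢a₀ = there (dead-nbr c (dead-c (nbr c a) (nbr-adj c a) (λ e → a≢a₀ (nbr-injective c e))))
  dead⊆U : deadOpposite cf c ⊆ U
  dead⊆U t∈ = unique-exhausts _≟T_ (Uniqueₚ.map⁺ (nbrTail-injective c) (moves-unique k)) U⊆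
    (subst (suc (length (deadOpposite cf c)) ≤_) (sym (trans (length-map (nbrTail c) (moves k)) (length-moves k))) (s≤s few))
    (there t∈)
  same-opposite : ∀ {c c'} → SameParity c c' → opposite c' ≡ opposite c
  same-opposite even = refl
  same-opposite odd = refl
  same-dead : ∀ {c c'} → SameParity c c' → deadOpposite cf c' ≡ deadOpposite cf c
  same-dead even = refl
  same-dead odd = refl
  towards : ∀ z → z ≢ b₀ → HAdj c (nbr c' z)
  towards z z≢b₀ with ∈-map⁻ (nbrTail c) (dead⊆U (subst (nbrTail c' z ∈_) (same-dead same)
                        (dead-nbr c' (dead-c' (nbr c' z) (nbr-adj c' z) (λ e → z≢b₀ (nbr-injective c' e))))))
  ... | a , _ , e = subst (HAdj c) (sym (trans (cong (λ f → f (nbrTail c' z)) (same-opposite same)) (cong (opposite c) e))) (nbr-adj c a)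

length-cartesianProductWith : ∀ {A B C : Set} (f : A → B → C) xs ys →
  length (cartesianProductWith f xs ys) ≡ length xs * length ys
length-cartesianProductWith f [] ys = refl
length-cartesianProductWith f (x ∷ xs) ys =
  trans (length-++ (map (f x) ys)) (cong₂ _+_ (length-map (f x) ys) (length-cartesianProductWith f xs ys))

allTails : ∀ k → List (Tail k)
allTails zero = [] ∷ []
allTails (suc k) = cartesianProductWith _∷_ (allFin 4) (allTails k)

allTails-complete : ∀ {k} (t : Tail k) → t ∈ allTails k
allTails-complete [] = here refl
allTails-complete (x ∷ t) = ∈-cartesianProductWith⁺ _∷_ (∈-allFin x) (allTails-complete t)

allTails-unique : ∀ k → Unique (allTails k)
allTails-unique zero = All.[] ∷ []
allTails-unique (suc k) =
  Uniqueₚ.cartesianProductWith⁺ _∷_ Vecₚ.∷-injective (Uniqueₚ.allFin⁺ 4) (allTails-unique k)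

length-allTails : ∀ k → length (allTails k) ≡ 4 ^ k
length-allTails zero = refl
length-allTails (suc k) = trans (length-cartesianProductWith _∷_ (allFin 4) (allTails k)) (cong (4 *_) (length-allTails k))

tail-avoid : ∀ {k} (L : List (Tail k)) → length L < 4 ^ k → ¬ ¬ (∃[ r ] r ∉ L)
tail-avoid {k} L L<4^k = unique-avoid _≟T_ (allTails-unique k) (subst (length L <_) (sym (length-allTails k)) L<4^k)
  >>= λ { (r , _ , r∉L) → pure (r , r∉L) }

bounded-opposite : ∀ {k b} {cf : Config k} → Bounded b cf → ∀ c → length (deadOpposite cf c) ≤ b
bounded-opposite (_ , fewO) (E _) = fewO
bounded-opposite (fewE , _) (O _) = fewE

-- The two statements proved together by induction on k ≥ 1: in a bounded
-- configuration of H_k, alive classes off isolated edges are connected, and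
-- isolated classes of a given parity are unique.
CoreConnected : ℕ → Set
CoreConnected k = ∀ (cf : Config k) → Bounded k cf → ∀ c c' → Alive cf c → Alive cf c' →
  ¬ Isolated cf c → ¬ Isolated cf c' → ¬ ¬ Walk cf c c'

UniqueIsolated : ℕ → Set
UniqueIsolated k = ∀ (cf : Config k) → Bounded k cf → ∀ {c c'} → SameParity c c' →
  Isolated cf c → Isolated cf c' → c ≡ c'

module _ {k : ℕ} where

  restrict : Fin 4 → List (Tail (suc k)) → List (Tail k)
  restrict x [] = []
  restrict x ((y ∷ r) ∷ L) with x ≟F y
  ... | yes _ = r ∷ restrict x L
  ... | no _ = restrict x L

  restrict⁺ : ∀ x {r} L → (x ∷ r) ∈ L → r ∈ restrict x L
  restrict⁺ x ((y ∷ r') ∷ L) x∷r∈ with x ≟F y | x∷r∈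
  ... | yes _ | here refl = here refl
  ... | yes _ | there x∷r∈L = there (restrict⁺ x L x∷r∈L)
  ... | no x≢y | here refl = ⊥-elim (x≢y refl)
  ... | no _ | there x∷r∈L = restrict⁺ x L x∷r∈L

  restrict⁻ : ∀ x {r} L → r ∈ restrict x L → (x ∷ r) ∈ L
  restrict⁻ x ((y ∷ r') ∷ L) r∈ with x ≟F y | r∈
  ... | yes refl | here refl = here refl
  ... | yes _ | there r∈L = there (restrict⁻ x L r∈L)
  ... | no _ | r∈L = there (restrict⁻ x L r∈L)

  count : Fin 4 → List (Tail (suc k)) → ℕ
  count x L = length (restrict x L)

  count≤length : ∀ x L → count x L ≤ length L
  count≤length x [] = z≤n
  count≤length x ((y ∷ r) ∷ L) with x ≟F y
  ... | yes _ = s≤s (count≤length x L)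
  ... | no _ = m≤n⇒m≤1+n (count≤length x L)

  count-two : ∀ {x y} L → x ≢ y → count x L + count y L ≤ length L
  count-two [] _ = z≤n
  count-two {x} {y} ((z ∷ r) ∷ L) x≢y with x ≟F z | y ≟F z | count-two L x≢y
  ... | yes refl | yes refl | _ = ⊥-elim (x≢y refl)
  ... | yes _ | no _ | ih = s≤s ih
  ... | no _ | yes _ | ih = subst (_≤ suc (length L)) (sym (+-suc _ _)) (s≤s ih)
  ... | no _ | no _ | ih = m≤n⇒m≤1+n ih

  count-three : ∀ {x y z} L → x ≢ y → x ≢ z → y ≢ z → count x L + count y L + count z L ≤ length L
  count-three [] _ _ _ = z≤n
  count-three {x} {y} {z} ((w ∷ r) ∷ L) x≢y x≢z y≢z with x ≟F w | y ≟F w | z ≟F w | count-three L x≢y x≢z y≢z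
  ... | yes refl | yes refl | _ | _ = ⊥-elim (x≢y refl)
  ... | yes refl | _ | yes refl | _ = ⊥-elim (x≢z refl)
  ... | _ | yes refl | yes refl | _ = ⊥-elim (y≢z refl)
  ... | yes _ | no _ | no _ | ih = s≤s ih
  ... | no _ | yes _ | no _ | ih = subst (_≤ suc (length L)) (sym (cong (_+ count z L) (+-suc _ _))) (s≤s ih)
  ... | no _ | no _ | yes _ | ih = subst (_≤ suc (length L)) (sym (+-suc _ _)) (s≤s ih)
  ... | no _ | no _ | no _ | ih = m≤n⇒m≤1+n ih

  AllHead : Fin 4 → List (Tail (suc k)) → Set
  AllHead x L = ∀ {t} → t ∈ L → head t ≡ x

  count-full : ∀ x L → length L ≤ count x L → AllHead x L
  count-full x ((y ∷ r) ∷ L) full t∈ with x ≟F y | t∈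
  ... | yes refl | here refl = refl
  ... | yes refl | there t∈L = count-full x L (≤-pred full) t∈L
  ... | no _ | _ = ⊥-elim (<⇒≱ full (count≤length x L))

  count-other : ∀ {x y} L → AllHead x L → y ≢ x → count y L ≡ 0
  count-other [] _ _ = refl
  count-other {x} {y} ((z ∷ r) ∷ L) all-x y≢x with y ≟F z
  ... | yes refl = ⊥-elim (y≢x (all-x (here refl)))
  ... | no _ = count-other L (λ t∈L → all-x (there t∈L)) y≢x

  count-zero-∉ : ∀ {x r} L → count x L ≡ 0 → (x ∷ r) ∉ L
  count-zero-∉ {x} L empty x∷r∈L with restrict x L | restrict⁺ x L x∷r∈L
  ... | _ ∷ _ | _ = case-absurd empty
    where
    case-absurd : ∀ {n} → suc n ≢ 0
    case-absurd ()

-- H_(k+1) consists of four copies of H_k, the copy x formed by the classes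
-- whose tail starts with x.  Inside a copy the edges are those of H_k;
-- besides, every class has one neighbour in an adjacent copy ("cross"
-- edge): E (x ∷ r) — O (x+1 ∷ r).
module _ {k : ℕ} where

  slice : Config (suc k) → Fin 4 → Config k
  slice cf x = config (restrict x (deadE cf)) (restrict x (deadO cf))

  lift : Fin 4 → Class k → Class (suc k)
  lift x (E r) = E (x ∷ r)
  lift x (O r) = O (x ∷ r)

  cross : Class (suc k) → Class (suc k)
  cross (E (x ∷ r)) = O (inc4 x ∷ r)
  cross (O (x ∷ r)) = E (dec4 x ∷ r)

  adj-cross : ∀ c → HAdj c (cross c)
  adj-cross (E (x ∷ r)) = inj₂ (zero , refl)
  adj-cross (O (x ∷ r)) = inj₂ (zero , cong (_∷ r) (sym (inc-dec x)))

  dead-lift : ∀ cf x a → Dead (slice cf x) a → Dead cf (lift x a)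
  dead-lift cf x (E r) = restrict⁻ x (deadE cf)
  dead-lift cf x (O r) = restrict⁻ x (deadO cf)

  alive-lift : ∀ cf x a → Alive (slice cf x) a → Alive cf (lift x a)
  alive-lift cf x (E r) alive d = alive (restrict⁺ x (deadE cf) d)
  alive-lift cf x (O r) alive d = alive (restrict⁺ x (deadO cf) d)

  lift-alive : ∀ cf x a → Alive cf (lift x a) → Alive (slice cf x) a
  lift-alive cf x a alive d = alive (dead-lift cf x a d)

  adj-lift : ∀ x {a b : Class k} → HAdj a b → HAdj (lift x a) (lift x b)
  adj-lift x {E r} {O s} (inj₁ refl) = inj₁ refl
  adj-lift x {E r} {O s} (inj₂ (i , refl)) = inj₂ (suc i , refl)
  adj-lift x {O s} {E r} (inj₁ refl) = inj₁ refl
  adj-lift x {O s} {E r} (inj₂ (i , refl)) = inj₂ (suc i , refl)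

  walk-lift : ∀ cf x {a b} → Walk (slice cf x) a b → Walk cf (lift x a) (lift x b)
  walk-lift cf x (start alive) = start (alive-lift cf x _ alive)
  walk-lift cf x (step p h alive) = step (walk-lift cf x p) (adj-lift x h) (alive-lift cf x _ alive)

  nbr-lift : ∀ x (a : Class k) c → HAdj (lift x a) c →
             (∃[ b ] c ≡ lift x b × HAdj a b) ⊎ c ≡ cross (lift x a)
  nbr-lift x (E r) (O (y ∷ s)) (inj₁ refl) = inj₁ (O r , refl , inj₁ refl)
  nbr-lift x (E r) (O (y ∷ s)) (inj₂ (zero , refl)) = inj₂ refl
  nbr-lift x (E r) (O (y ∷ s)) (inj₂ (suc i , refl)) = inj₁ (O (r [ i ]%= inc4) , refl , inj₂ (i , refl))
  nbr-lift x (O s) (E (y ∷ t)) (inj₁ refl) = inj₁ (E t , refl , inj₁ refl)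
  nbr-lift x (O s) (E (y ∷ t)) (inj₂ (zero , refl)) = inj₂ (cong (λ z → E (z ∷ t)) (sym (dec-inc y)))
  nbr-lift x (O s) (E (y ∷ t)) (inj₂ (suc i , refl)) = inj₁ (E t , refl , inj₂ (i , refl))

  isolated-escape : ∀ cf x a → (i : Isolated (slice cf x) a) → ¬ Isolated cf (lift x a) →
    Alive cf (cross (lift x a)) ⊎ Alive cf (cross (lift x (proj₁ i)))
  isolated-escape cf x a (b , h , alive , dead-a , dead-b) ¬isolated
    with dead? cf (cross (lift x a)) | dead? cf (cross (lift x b))
  ... | no alive₁ | _ = inj₁ alive₁
  ... | yes _ | no alive₂ = inj₂ alive₂
  ... | yes dead₁ | yes dead₂ =
    ⊥-elim (¬isolated (lift x b , adj-lift x h , alive-lift cf x b alive , others-dead dead-a dead₁ , others-dead dead-b dead₂))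
    where
    others-dead : ∀ {a b} → (∀ e → HAdj a e → e ≢ b → Dead (slice cf x) e) → Dead cf (cross (lift x a)) →
                  ∀ e → HAdj (lift x a) e → e ≢ lift x b → Dead cf e
    others-dead {a} dead-in dead-cross e h e≢ with nbr-lift x a e h
    ... | inj₁ (b' , refl , h') = dead-lift cf x b' (dead-in b' h' (λ q → e≢ (cong (lift x) q)))
    ... | inj₂ refl = dead-cross

≤-by : ∀ {m n} e → n ≡ m + e → m ≤ n
≤-by e refl = m≤m+n _ e

3k+1≤4^k : ∀ k → 3 * k + 1 ≤ 4 ^ k
3k+1≤4^k zero = s≤s z≤n
3k+1≤4^k (suc k) = ≤-trans (≤-by (9 * k) (expand k)) (*-monoʳ-≤ 4 (3k+1≤4^k k))
  where
  expand : ∀ k → 4 * (3 * k + 1) ≡ (3 * suc k + 1) + 9 * k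
  expand = solve-∀

short<4^k : ∀ {k a} → 1 ≤ k → a ≤ suc k → a < 4 ^ k
short<4^k {zero} () _
short<4^k {suc j} _ a≤ = ≤-trans (s≤s a≤) (≤-trans (≤-by (suc (j + j)) (expand j)) (3k+1≤4^k (suc j)))
  where
  expand : ∀ j → 3 * suc j + 1 ≡ suc (suc (suc j)) + suc (j + j)
  expand = solve-∀

two-rows<4^k : ∀ {k a b c d} → 2 ≤ k → a ≤ k → b ≤ 1 → c ≤ k → d ≤ 1 → a + (b + (c + d)) < 4 ^ k
two-rows<4^k {zero} ()
two-rows<4^k {suc zero} (s≤s ())
two-rows<4^k {suc (suc j)} _ a≤ b≤ c≤ d≤ =
  ≤-trans (s≤s (+-mono-≤ a≤ (+-mono-≤ b≤ (+-mono-≤ c≤ d≤))))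
          (≤-trans (≤-by j (expand j)) (3k+1≤4^k (suc (suc j))))
  where
  expand : ∀ j → 3 * suc (suc j) + 1 ≡ suc (suc (suc j) + (1 + (suc (suc j) + 1))) + j
  expand = solve-∀

two-rows<4^k′ : ∀ {k a b c d} → 1 ≤ k → a ≤ k → c ≤ k → b + d ≤ 1 → a + (b + (c + d)) < 4 ^ k
two-rows<4^k′ {zero} ()
two-rows<4^k′ {suc j} {a} {b} {c} {d} _ a≤ c≤ b+d≤ =
  ≤-trans (s≤s (subst (_≤ suc j + suc j + 1) (sym (regroup a b c d)) (+-mono-≤ (+-mono-≤ a≤ c≤) b+d≤)))
          (≤-trans (≤-by j (expand j)) (3k+1≤4^k (suc j)))
  where
  regroup : ∀ a b c d → a + (b + (c + d)) ≡ (a + c) + (b + d)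
  regroup = solve-∀
  expand : ∀ j → 3 * suc j + 1 ≡ suc (suc j + suc j + 1) + j
  expand = solve-∀

-- Assume CoreConnected k and UniqueIsolated k for
-- some k ≥ 1 and fix a configuration cf of H_(k+1) bounded by k+1.  A
-- copy is good when its own configuration is bounded by k; a class of a
-- good copy is regular when it is alive and not isolated inside the copy,
-- so the induction hypothesis connects all regular classes of one copy.
-- We show that all regular classes of all copies are connected (all-joined)
-- and that every alive, non-isolated class reaches a regular one (reach).
module Step (k : ℕ) (1≤k : 1 ≤ k) (IH : CoreConnected k) (unique : UniqueIsolated k)
            (cf : Config (suc k)) (bounded : Bounded (suc k) cf) where

  DE DO : List (Tail (suc k))
  DE = deadE cf
  DO = deadO cf

  nE nO : Fin 4 → ℕ
  nE x = count x DE
  nO x = count x DO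

  Good : Fin 4 → Set
  Good x = Bounded k (slice cf x)

  IsolatedIn : Fin 4 → Class k → Set
  IsolatedIn x = Isolated (slice cf x)

  Regular : Fin 4 → Class k → Set
  Regular x a = Good x × Alive (slice cf x) a × ¬ IsolatedIn x a

  Heavy : Fin 4 → Set
  Heavy x = ∃[ a ] IsolatedIn x a

  heavy-bound : ∀ {x} → Heavy x → k ≤ nE x × k ≤ nO x
  heavy-bound (_ , i) = isolated-heavy i

  Joined : Fin 4 → Fin 4 → Set
  Joined y z = ∀ a b → Regular y a → Regular z b → ¬ ¬ Walk cf (lift y a) (lift z b)

  joined-self : ∀ y → Joined y y
  joined-self y a b (good , alive-a , ¬iso-a) (_ , alive-b , ¬iso-b) =
    IH (slice cf y) good a b alive-a alive-b ¬iso-a ¬iso-b >>= λ p → pure (walk-lift cf y p)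

  joined-sym : ∀ {y z} → Joined y z → Joined z y
  joined-sym j a b reg-a reg-b = j b a reg-b reg-a >>= λ p → pure (walk-sym p)

  joined-trans : ∀ {y w z} → Joined y w → Joined w z → ∃[ m ] Regular w m → Joined y z
  joined-trans j₁ j₂ (m , reg-m) a b reg-a reg-b =
    j₁ a m reg-a reg-m >>= λ p → j₂ m b reg-m reg-b >>= λ q → pure (walk-trans p q)

  -- A link from copy x to copy x+1: a tail r with E r regular in copy x
  -- and O r regular in copy x+1; the cross edge between them joins the copies.
  Link : Fin 4 → Set
  Link x = ∃[ r ] Regular x (E r) × Regular (inc4 x) (O r)

  link-joins : ∀ {x} → Link x → Joined x (inc4 x)
  link-joins {x} (r , reg-E , reg-O) a b reg-a reg-b =
    joined-self x a (E r) reg-a reg-E >>= λ p →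
    joined-self (inc4 x) (O r) b reg-O reg-b >>= λ q →
    pure (walk-trans p (walk-trans (walk-edge (alive-lift cf x (E r) (proj₁ (proj₂ reg-E))) (adj-cross (E (x ∷ r)))
                                             (alive-lift cf (inc4 x) (O r) (proj₁ (proj₂ reg-O)))) q))

  k≡1⊎2≤k : k ≡ 1 ⊎ 2 ≤ k
  k≡1⊎2≤k = one-or-more 1≤k
    where
    one-or-more : ∀ {n} → 1 ≤ n → n ≡ 1 ⊎ 2 ≤ n
    one-or-more {suc zero} _ = inj₁ refl
    one-or-more {suc (suc _)} _ = inj₂ (s≤s (s≤s z≤n))

  -- The only situation in which adjacent good copies need not be linked.
  DoubleHeavy : Fin 4 → Set
  DoubleHeavy x = k ≡ 1 × Heavy x × Heavy (inc4 x)

  record IsolatedTails (x : Fin 4) (cl : Tail k → Class k) : Set where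
    field
      tails : List (Tail k)
      covers : ∀ {r} → IsolatedIn x (cl r) → r ∈ tails
      at-most-one : length tails ≤ 1
      only-if-heavy : 1 ≤ length tails → Heavy x

  isolated-tails : ∀ x (cl : Tail k → Class k) → (∀ {t t'} → cl t ≡ cl t' → t ≡ t') →
    (∀ {t t'} → SameParity (cl t) (cl t')) → Good x → ¬ ¬ IsolatedTails x cl
  isolated-tails x cl cl-injective same good = ¬¬-excluded-middle {A = ∃[ t ] IsolatedIn x (cl t)} >>= λ
    { (yes (t , iso-t)) → pure record
        { tails = t ∷ [] ; covers = λ iso-r → here (cl-injective (unique (slice cf x) good same iso-r iso-t))
        ; at-most-one = s≤s z≤n ; only-if-heavy = λ _ → cl t , iso-t }
    ; (no none) → pure record
        { tails = [] ; covers = λ iso-r → ⊥-elim (none (_ , iso-r)) ; at-most-one = z≤n ; only-if-heavy = λ () } }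

  -- Adjacent good copies are linked (unless double heavy): the tails r
  -- excluded from a link are the dead or isolated ones in either copy, and
  -- there are fewer than 4^k of them.
  link-exists : ∀ x → Good x → Good (inc4 x) → ¬ DoubleHeavy x → ¬ ¬ Link x
  link-exists x good good' ¬double =
    isolated-tails x E (λ { refl → refl }) even good >>= λ IE →
    isolated-tails (inc4 x) O (λ { refl → refl }) odd good' >>= λ IO →
    link-avoiding IE IO
    where
    link-avoiding : IsolatedTails x E → IsolatedTails (inc4 x) O → ¬ ¬ Link x
    link-avoiding IE IO = tail-avoid excluded excluded<4^k >>= λ { (r , r∉) → pure (r ,
        (good , (λ d → r∉ (∈-++⁺ˡ d)) , λ iso → r∉ (∈-++⁺ʳ (restrict x DE) (∈-++⁺ˡ (covers IE iso)))) ,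
        (good' , (λ d → r∉ (∈-++⁺ʳ (restrict x DE) (∈-++⁺ʳ (tails IE) (∈-++⁺ˡ d)))) ,
          λ iso → r∉ (∈-++⁺ʳ (restrict x DE) (∈-++⁺ʳ (tails IE) (∈-++⁺ʳ (restrict (inc4 x) DO) (covers IO iso)))))) }
      where
      open IsolatedTails
      excluded : List (Tail k)
      excluded = restrict x DE ++ (tails IE ++ (restrict (inc4 x) DO ++ tails IO))
      length-excluded : length excluded ≡ nE x + (length (tails IE) + (nO (inc4 x) + length (tails IO)))
      length-excluded = trans (length-++ (restrict x DE))
        (cong (nE x +_) (trans (length-++ (tails IE)) (cong (length (tails IE) +_) (length-++ (restrict (inc4 x) DO)))))
      excluded<4^k : length excluded < 4 ^ k
      excluded<4^k rewrite length-excluded with k≡1⊎2≤k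
      ... | inj₂ 2≤k = two-rows<4^k 2≤k (proj₁ good) (at-most-one IE) (proj₂ good') (at-most-one IO)
      ... | inj₁ k≡1 = two-rows<4^k′ {b = length (tails IE)} {d = length (tails IO)} 1≤k (proj₁ good) (proj₂ good')
        (at-most-one-nonempty (at-most-one IE) (at-most-one IO) (λ ne₁ ne₂ → ¬double (k≡1 , only-if-heavy IE ne₁ , only-if-heavy IO ne₂)))
        where
        at-most-one-nonempty : ∀ {a b} → a ≤ 1 → b ≤ 1 → (1 ≤ a → 1 ≤ b → ⊥) → a + b ≤ 1
        at-most-one-nonempty {zero} _ b≤1 _ = b≤1
        at-most-one-nonempty {suc zero} {zero} _ _ _ = s≤s z≤n
        at-most-one-nonempty {suc zero} {suc _} _ _ both = ⊥-elim (both (s≤s z≤n) (s≤s z≤n))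
        at-most-one-nonempty {suc (suc _)} (s≤s ()) _ _

  DE≤ : length DE ≤ suc k
  DE≤ = proj₁ bounded
  DO≤ : length DO ≤ suc k
  DO≤ = proj₂ bounded

  -- A copy that is not good holds more than k of the at most k+1 dead
  -- classes of one parity, hence all of them.
  not-good : ∀ {x} → ¬ Good x → ¬ (nE x ≤ k) ⊎ ¬ (nO x ≤ k)
  not-good {x} ¬good with nE x ≤? k | nO x ≤? k
  ... | yes E≤ | yes O≤ = ⊥-elim (¬good (E≤ , O≤))
  ... | no E≰ | _ = inj₁ E≰
  ... | yes _ | no O≰ = inj₂ O≰

  overfullE : ∀ {x} → ¬ (nE x ≤ k) → AllHead x DE
  overfullE {x} E≰ = count-full x DE (≤-trans DE≤ (≰⇒> E≰))

  overfullO : ∀ {x} → ¬ (nO x ≤ k) → AllHead x DO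
  overfullO {x} O≰ = count-full x DO (≤-trans DO≤ (≰⇒> O≰))

  none≤k : ∀ {n} → n ≡ 0 → n ≤ k
  none≤k refl = z≤n

  bad-without-deadE : ∀ {y} → ¬ Good y → nE y ≡ 0 → AllHead y DO
  bad-without-deadE ¬good none with not-good ¬good
  ... | inj₁ E≰ = ⊥-elim (E≰ (none≤k none))
  ... | inj₂ O≰ = overfullO O≰

  bad-without-deadO : ∀ {y} → ¬ Good y → nO y ≡ 0 → AllHead y DE
  bad-without-deadO ¬good none with not-good ¬good
  ... | inj₁ E≰ = overfullE E≰
  ... | inj₂ O≰ = ⊥-elim (O≰ (none≤k none))

  no-deadE-not-heavy : ∀ {y} → nE y ≡ 0 → ¬ Heavy y
  no-deadE-not-heavy none heavy = <⇒≱ 1≤k (subst (k ≤_) none (proj₁ (heavy-bound heavy)))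

  no-deadO-not-heavy : ∀ {y} → nO y ≡ 0 → ¬ Heavy y
  no-deadO-not-heavy none heavy = <⇒≱ 1≤k (subst (k ≤_) none (proj₂ (heavy-bound heavy)))

  aliveE-empty : ∀ {y} r → nE y ≡ 0 → Alive cf (E (y ∷ r))
  aliveE-empty r none = count-zero-∉ DE none

  aliveO-empty : ∀ {y} r → nO y ≡ 0 → Alive cf (O (y ∷ r))
  aliveO-empty r none = count-zero-∉ DO none

  regular : ∀ {y} a → Good y → Alive cf (lift y a) → ¬ Heavy y → Regular y a
  regular {y} a good alive ¬heavy = good , lift-alive cf y a alive , λ iso → ¬heavy (a , iso)

  module DoubleHeavyFacts {x} (double : DoubleHeavy x) where
    private
      k≡1 = proj₁ double
      ≤2 : ∀ {n} → n ≤ suc k → n ≤ 2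
      ≤2 {n} le = subst (λ m → n ≤ suc m) k≡1 le
      ≤k : ∀ {n} → n ≤ 1 → n ≤ k
      ≤k {n} le = subst (n ≤_) (sym k≡1) le
      one≤ : ∀ {n} → k ≤ n → 1 ≤ n
      one≤ {n} le = subst (_≤ n) k≡1 le
      E₁ = one≤ (proj₁ (heavy-bound (proj₁ (proj₂ double))))
      E₂ = one≤ (proj₁ (heavy-bound (proj₂ (proj₂ double))))
      O₁ = one≤ (proj₂ (heavy-bound (proj₁ (proj₂ double))))
      O₂ = one≤ (proj₂ (heavy-bound (proj₂ (proj₂ double))))
      squeeze₀ : ∀ {a b c} → 1 ≤ a → 1 ≤ b → a + b + c ≤ 2 → c ≡ 0
      squeeze₀ {a} {b} {c} 1≤a 1≤b le = two+c≤2 c (≤-trans (+-monoˡ-≤ c (+-mono-≤ 1≤a 1≤b)) le)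
        where
        two+c≤2 : ∀ c → 2 + c ≤ 2 → c ≡ 0
        two+c≤2 zero _ = refl
        two+c≤2 (suc c) (s≤s (s≤s ()))
      squeeze₁ : ∀ {a b} → 1 ≤ b → a + b ≤ 2 → a ≤ 1
      squeeze₁ {a} {suc b} _ le = ≤-pred (≤-trans (s≤s (m≤m+n a b)) (subst (_≤ 2) (+-suc a b) le))
      x≢x+1 : x ≢ inc4 x
      x≢x+1 e = inc≢id x (sym e)

    others-empty : ∀ y → y ≢ x → y ≢ inc4 x → nE y ≡ 0 × nO y ≡ 0
    others-empty y y≢x y≢x+1 =
      squeeze₀ E₁ E₂ (≤-trans (count-three DE x≢x+1 (≢-sym y≢x) (≢-sym y≢x+1)) (≤2 DE≤)) ,
      squeeze₀ O₁ O₂ (≤-trans (count-three DO x≢x+1 (≢-sym y≢x) (≢-sym y≢x+1)) (≤2 DO≤))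

    all-good : ∀ y → Good y
    all-good y with y ≟F x | y ≟F inc4 x
    ... | yes refl | _ =
      ≤k (squeeze₁ E₂ (≤-trans (count-two DE x≢x+1) (≤2 DE≤))) , ≤k (squeeze₁ O₂ (≤-trans (count-two DO x≢x+1) (≤2 DO≤)))
    ... | no _ | yes refl =
      ≤k (squeeze₁ E₁ (≤-trans (≤-reflexive (+-comm (nE (inc4 x)) (nE x))) (≤-trans (count-two DE x≢x+1) (≤2 DE≤)))) ,
      ≤k (squeeze₁ O₁ (≤-trans (≤-reflexive (+-comm (nO (inc4 x)) (nO x))) (≤-trans (count-two DO x≢x+1) (≤2 DO≤))))
    ... | no y≢x | no y≢x+1 = none≤k (proj₁ (others-empty y y≢x y≢x+1)) , none≤k (proj₂ (others-empty y y≢x y≢x+1))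

    only-pair : ∀ {x'} → DoubleHeavy x' → x' ≡ x
    only-pair {x'} double' with x' ≟F x | x' ≟F inc4 x
    ... | yes x'≡x | _ = x'≡x
    ... | no x'≢x | no x'≢x+1 = ⊥-elim (no-deadE-not-heavy (proj₁ (others-empty x' x'≢x x'≢x+1)) (proj₁ (proj₂ double')))
    ... | no _ | yes refl = ⊥-elim (no-deadE-not-heavy (proj₁ (others-empty (inc4 (inc4 x)) (inc²≢id x) (inc≢id (inc4 x))))
                                                       (proj₂ (proj₂ double')))

  open DoubleHeavyFacts using (all-good; only-pair)

  not-good-not-double : ∀ {y x} → ¬ Good y → ¬ DoubleHeavy x
  not-good-not-double ¬good double = ¬good (all-good double _)

  Bridged : Fin 4 → Fin 4 → Set
  Bridged y z = Joined y z × (∃[ a ] Regular y a) × (∃[ b ] Regular z b)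

  bridged-sym : ∀ {y z} → Bridged y z → Bridged z y
  bridged-sym (j , reg-y , reg-z) = joined-sym j , reg-z , reg-y

  bridged-cong : ∀ {y y' z z'} → y ≡ y' → z ≡ z' → Bridged y z → Bridged y' z'
  bridged-cong refl refl b = b

  chain : ∀ {y w z} → Bridged y w → Bridged w z → Joined y z
  chain (j₁ , _ , reg-w) (j₂ , _ , _) = joined-trans j₁ j₂ reg-w

  chain₃ : ∀ {y w v z} → Bridged y w → Bridged w v → Bridged v z → Joined y z
  chain₃ (j₁ , _ , reg-w) (j₂ , _ , reg-v) (j₃ , _ , _) = joined-trans (joined-trans j₁ j₂ reg-w) j₃ reg-v

  link-bridged : ∀ x → Good x → Good (inc4 x) → ¬ DoubleHeavy x → ¬ ¬ Bridged x (inc4 x)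
  link-bridged x good good' ¬double = link-exists x good good' ¬double >>= λ
    { link@(r , reg-E , reg-O) → pure (link-joins link , (E r , reg-E) , (O r , reg-O)) }

  -- Adjacent copies are joined: directly by a link, or, around a double
  -- heavy pair, the other way round the cycle of copies.
  adjacent-joined : ∀ y → Joined y (inc4 y)
  adjacent-joined y a b reg-a reg-b = ¬¬-excluded-middle {A = DoubleHeavy y} >>= λ
    { (no ¬double) → link-bridged y (proj₁ reg-a) (proj₁ reg-b) ¬double >>= λ B → proj₁ B a b reg-a reg-b
    ; (yes double) →
        link-bridged (dec4 y) (all-good double _) (all-good double _) (λ d → dec≢id y (only-pair double d)) >>= λ B₁ →
        link-bridged (dec4 (dec4 y)) (all-good double _) (all-good double _) (λ d → dec²≢id y (only-pair double d)) >>= λ B₂ →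
        link-bridged (inc4 y) (all-good double _) (all-good double _) (λ d → inc≢id y (only-pair double d)) >>= λ B₃ →
        chain₃ (bridged-sym (bridged-cong refl (inc-dec y) B₁))
               (bridged-sym (bridged-cong refl (inc-dec (dec4 y)) B₂))
               (bridged-sym (bridged-cong refl (inc²≡dec² y) B₃)) a b reg-a reg-b }

  -- If copy b holds all dead even classes and copy b+2 all dead odd ones,
  -- copies b+1 and b-1 are joined through copy b: for a tail r with
  -- E (b ∷ r) alive, O (b+1 ∷ r) — E (b ∷ r) — O (b ∷ r) — E (b-1 ∷ r)
  -- is a path through alive classes.
  through-full-copy : ∀ b → AllHead b DE → AllHead (inc4 (inc4 b)) DO → Joined (inc4 b) (dec4 b)
  through-full-copy b allE allO a a' reg-a reg-a' =
    tail-avoid (restrict b DE) (short<4^k 1≤k (≤-trans (count≤length b DE) DE≤)) >>= λ { (r , r∉) →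
    joined-self (inc4 b) a (O r) reg-a (regular (O r) good₁ (aliveO-empty r O₁) (no-deadE-not-heavy E₁)) >>= λ p →
    joined-self (dec4 b) (E r) a' (regular (E r) good₂ (aliveE-empty r E₂) (no-deadE-not-heavy E₂)) reg-a' >>= λ q →
    pure (walk-trans p (walk-trans (path r (λ d → r∉ (restrict⁺ b DE d))) q)) }
    where
    E₁ : nE (inc4 b) ≡ 0
    E₁ = count-other DE allE (inc≢id b)
    O₁ : nO (inc4 b) ≡ 0
    O₁ = count-other DO allO (λ e → inc≢id (inc4 b) (sym e))
    E₂ : nE (dec4 b) ≡ 0
    E₂ = count-other DE allE (dec≢id b)
    O₂ : nO (dec4 b) ≡ 0
    O₂ = count-other DO allO (λ e → inc²≢dec b (sym e))
    O₀ : nO b ≡ 0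
    O₀ = count-other DO allO (λ e → inc²≢id b (sym e))
    good₁ : Good (inc4 b)
    good₁ = none≤k E₁ , none≤k O₁
    good₂ : Good (dec4 b)
    good₂ = none≤k E₂ , none≤k O₂
    path : ∀ r → Alive cf (E (b ∷ r)) → Walk cf (O (inc4 b ∷ r)) (E (dec4 b ∷ r))
    path r alive =
      step {b = O (b ∷ r)} (step {b = E (b ∷ r)} (walk-edge (aliveO-empty r O₁) (HAdj-sym {c = E (b ∷ r)} {O (inc4 b ∷ r)} (adj-cross (E (b ∷ r)))) alive)
                 (inj₁ refl) (aliveO-empty r O₀))
           (adj-cross (O (b ∷ r))) (aliveE-empty r E₂)

  -- Opposite copies are joined: through a good neighbouring copy, or, if
  -- both neighbours are bad, through a copy holding all dead classes of one
  -- parity.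
  opposite-joined : ∀ y → Joined y (inc4 (inc4 y))
  opposite-joined y a b reg-a reg-b = ¬¬-excluded-middle {A = Good (inc4 y)} >>= λ
    { (yes good₁) → ¬¬-excluded-middle {A = DoubleHeavy y ⊎ DoubleHeavy (inc4 y)} >>= λ
        { (no ¬double) → link-bridged y good-y good₁ (λ d → ¬double (inj₁ d)) >>= λ B₁ →
                         link-bridged (inc4 y) good₁ good-z (λ d → ¬double (inj₂ d)) >>= λ B₂ → chain B₁ B₂ a b reg-a reg-b
        ; (yes (inj₁ double)) → via-dec (all-good double _) (λ d → dec≢id y (only-pair double d)) (λ d → inc²≢id y (only-pair double d))
        ; (yes (inj₂ double)) → via-dec (all-good double _) (λ d → inc≢dec y (sym (only-pair double d))) (λ d → inc≢id (inc4 y) (only-pair double d)) }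
    ; (no ¬good₁) → ¬¬-excluded-middle {A = Good (dec4 y)} >>= λ
        { (yes good₃) → via-dec good₃ (not-good-not-double ¬good₁) (not-good-not-double ¬good₁)
        ; (no ¬good₃) → both-bad ¬good₁ ¬good₃ } }
    where
    good-y = proj₁ reg-a
    good-z = proj₁ reg-b
    via-dec : Good (dec4 y) → ¬ DoubleHeavy (dec4 y) → ¬ DoubleHeavy (inc4 (inc4 y)) → ¬ ¬ Walk cf (lift y a) (lift (inc4 (inc4 y)) b)
    via-dec good₃ ¬double₁ ¬double₂ =
      link-bridged (dec4 y) good₃ (subst Good (sym (inc-dec y)) good-y) ¬double₁ >>= λ B₁ →
      link-bridged (inc4 (inc4 y)) good-z (subst Good (sym (inc³≡dec y)) good₃) ¬double₂ >>= λ B₂ →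
      chain (bridged-sym (bridged-cong refl (inc-dec y) B₁)) (bridged-sym (bridged-cong refl (inc³≡dec y) B₂)) a b reg-a reg-b
    both-bad : ¬ Good (inc4 y) → ¬ Good (dec4 y) → ¬ ¬ Walk cf (lift y a) (lift (inc4 (inc4 y)) b)
    both-bad ¬good₁ ¬good₃ with not-good ¬good₁
    ... | inj₁ E≰ = joined-sym (subst (Joined (inc4 (inc4 y))) (dec-inc y)
                      (through-full-copy (inc4 y) allE (subst (λ z → AllHead z DO) (sym (inc³≡dec y)) allO))) a b reg-a reg-b
      where
      allE : AllHead (inc4 y) DE
      allE = overfullE E≰
      allO : AllHead (dec4 y) DO
      allO = bad-without-deadE ¬good₃ (count-other DE allE (λ e → inc≢dec y (sym e)))
    ... | inj₂ O≰ = subst₂ Joined (inc-dec y) (sym (inc²≡dec² y))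
                      (through-full-copy (dec4 y) allE (subst (λ z → AllHead z DO) (sym (cong inc4 (inc-dec y))) allO)) a b reg-a reg-b
      where
      allO : AllHead (inc4 y) DO
      allO = overfullO O≰
      allE : AllHead (dec4 y) DE
      allE = bad-without-deadO ¬good₃ (count-other DO allO (λ e → inc≢dec y (sym e)))

  all-joined : ∀ y z → Joined y z
  all-joined y z with four-positions y z
  ... | inj₁ refl = joined-self y
  ... | inj₂ (inj₁ refl) = adjacent-joined y
  ... | inj₂ (inj₂ (inj₁ refl)) = joined-sym (subst (Joined (dec4 y)) (inc-dec y) (adjacent-joined (dec4 y)))
  ... | inj₂ (inj₂ (inj₂ refl)) = opposite-joined y

  ReachesRegular : Class (suc k) → Set
  ReachesRegular c = ∃[ y ] ∃[ a ] Regular y a × Walk cf c (lift y a)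

  reach-via : ∀ {c q} → Alive cf c → HAdj c q → Alive cf q → ReachesRegular q → ReachesRegular c
  reach-via alive h alive-q (y , a , reg , p) = y , a , reg , walk-trans (walk-edge alive h alive-q) p

  alive-empty-copy : ∀ {y} → nE y ≡ 0 → nO y ≡ 0 → ∀ a → Alive cf (lift y a)
  alive-empty-copy noE _ (E r) = aliveE-empty r noE
  alive-empty-copy _ noO (O r) = aliveO-empty r noO

  regular-empty-copy : ∀ {y} → nE y ≡ 0 → nO y ≡ 0 → ∀ a → Regular y a
  regular-empty-copy noE noO a = regular a (none≤k noE , none≤k noO) (alive-empty-copy noE noO a) (no-deadE-not-heavy noE)

  into-empty-copy : ∀ {c} y a → nE y ≡ 0 → nO y ≡ 0 → Alive cf c → HAdj c (lift y a) → ReachesRegular c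
  into-empty-copy y a noE noO alive h = y , a , regular-empty-copy noE noO a , walk-edge alive h (alive-empty-copy noE noO a)

  E-heads≢ : ∀ {x y : Fin 4} {r t : Tail k} → x ≢ y → E (x ∷ r) ≢ E (y ∷ t)
  E-heads≢ x≢y refl = x≢y refl

  O-heads≢ : ∀ {x y : Fin 4} {r t : Tail k} → x ≢ y → O (x ∷ r) ≢ O (y ∷ t)
  O-heads≢ x≢y refl = x≢y refl

  -- For an odd
  -- class its cross neighbour W = E (x-1 ∷ s) is alive; if copy x-1 is bad
  -- it holds all dead odd classes, and the empty copies x+1 and x-2 are
  -- reached through an alive even neighbour inside copy x or, as the edge to
  -- W is not isolated, through another alive neighbour of W.  An even class
  -- reaches copy x-1 through O (x ∷ r) if its cross neighbour is alive,
  -- and otherwise an alive odd neighbour inside copy x.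
  module FullEven (x : Fin 4) (allE : AllHead x DE) where
    noE : ∀ {y} → y ≢ x → nE y ≡ 0
    noE = count-other DE allE

    reach-odd : ∀ s → Alive cf (O (x ∷ s)) → ¬ Isolated cf (O (x ∷ s)) → ¬ ¬ ReachesRegular (O (x ∷ s))
    reach-odd s alive ¬iso = ¬¬-excluded-middle {A = Good (dec4 x)} >>= λ
      { (yes good) → pure (dec4 x , E s , regular (E s) good alive-W (no-deadE-not-heavy (noE (dec≢id x))) ,
                           walk-edge alive (adj-cross (O (x ∷ s))) alive-W)
      ; (no ¬good) → via-empty-copies (bad-without-deadE ¬good (noE (dec≢id x))) }
      where
      alive-W : Alive cf (E (dec4 x ∷ s))
      alive-W = aliveE-empty s (noE (dec≢id x))
      via-empty-copies : AllHead (dec4 x) DO → ¬ ¬ ReachesRegular (O (x ∷ s))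
      via-empty-copies allO = ¬¬-excluded-middle {A = ∃[ t ] HAdj (O s) (E t) × Alive cf (E (x ∷ t))} >>= λ
        { (yes (t , h , alive-t)) → pure (reach-via {q = E (x ∷ t)} alive (adj-lift x {O s} {E t} h) alive-t
            (into-empty-copy (inc4 x) (O t) (noE (inc≢id x)) (count-other DO allO (inc≢dec x)) alive-t (adj-cross (E (x ∷ t)))))
        ; (no none-inside) → ¬¬-excluded-middle {A = ∃[ p ] HAdj (E (dec4 x ∷ s)) p × p ≢ O (x ∷ s) × Alive cf p} >>= λ
          { (no none-at-W) → ⊥-elim (¬iso (E (dec4 x ∷ s) , adj-cross (O (x ∷ s)) , alive-W ,
                                            inside-dead none-inside , at-W-dead none-at-W))
          ; (yes (p , h , p≢ , alive-p)) → pure (beyond-W p h p≢ alive-p) } }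
        where
        inside-dead : ¬ (∃[ t ] HAdj (O s) (E t) × Alive cf (E (x ∷ t))) →
                      ∀ e → HAdj (O (x ∷ s)) e → e ≢ E (dec4 x ∷ s) → Dead cf e
        inside-dead none e h e≢W with nbr-lift x (O s) e h
        ... | inj₂ e≡W = ⊥-elim (e≢W e≡W)
        ... | inj₁ (E t , refl , h') = not-alive cf (E (x ∷ t)) λ alive-t → none (t , h' , alive-t)
        ... | inj₁ (O t , refl , ())
        at-W-dead : ¬ (∃[ p ] HAdj (E (dec4 x ∷ s)) p × p ≢ O (x ∷ s) × Alive cf p) →
                    ∀ e → HAdj (E (dec4 x ∷ s)) e → e ≢ O (x ∷ s) → Dead cf e
        at-W-dead none e h e≢ = not-alive cf e λ alive-e → none (e , h , e≢ , alive-e)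
        beyond-W : ∀ p → HAdj (E (dec4 x ∷ s)) p → p ≢ O (x ∷ s) → Alive cf p → ReachesRegular (O (x ∷ s))
        beyond-W p h p≢ alive-p with nbr-lift (dec4 x) (E s) p h
        ... | inj₂ refl = ⊥-elim (p≢ (cong (λ z → O (z ∷ s)) (inc-dec x)))
        ... | inj₁ (E u , refl , ())
        ... | inj₁ (O u , refl , _) = reach-via {q = E (dec4 x ∷ s)} alive (adj-cross (O (x ∷ s))) alive-W (reach-via {q = O (dec4 x ∷ u)} alive-W h alive-p
                (into-empty-copy (dec4 (dec4 x)) (E u) (noE (dec²≢id x)) (count-other DO allO (dec≢id (dec4 x))) alive-p (adj-cross (O (dec4 x ∷ u)))))

    reach-even : ∀ r → Alive cf (E (x ∷ r)) → ¬ Isolated cf (E (x ∷ r)) → ¬ ¬ ReachesRegular (E (x ∷ r))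
    reach-even r alive ¬iso = ¬¬-excluded-middle {A = Alive cf (O (inc4 x ∷ r))} >>= λ
      { (yes alive-W) → ¬¬-excluded-middle {A = Good (inc4 x)} >>= λ
          { (yes good) → pure (inc4 x , O r , regular (O r) good alive-W (no-deadE-not-heavy (noE (inc≢id x))) ,
                               walk-edge alive (adj-cross (E (x ∷ r))) alive-W)
          ; (no ¬good) → pure (via-own-odd (bad-without-deadE ¬good (noE (inc≢id x)))) }
      ; (no dead-W) → ¬¬-excluded-middle {A = ∃[ s ] HAdj (E r) (O s) × Alive cf (O (x ∷ s))} >>= λ
          { (yes (s , h , alive-s)) →
              reach-odd s alive-s (two-neighbours-not-isolated (HAdj-sym {c = E (x ∷ r)} {O (x ∷ s)} (adj-lift x {E r} {O s} h)) alive
                                     (adj-cross (O (x ∷ s))) (aliveE-empty s (noE (dec≢id x))) (E-heads≢ (≢-sym (dec≢id x)))) >>= λ R →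
              pure (reach-via {q = O (x ∷ s)} alive (adj-lift x {E r} {O s} h) alive-s R)
          ; (no none-inside) → ⊥-elim (<⇒≱ (s≤s ≤-refl) (≤-trans (all-neighbours-dead (E (x ∷ r)) (all-dead dead-W none-inside)) DO≤)) } }
      where
      via-own-odd : AllHead (inc4 x) DO → ReachesRegular (E (x ∷ r))
      via-own-odd allO = reach-via {q = O (x ∷ r)} alive (inj₁ refl) alive-own
        (into-empty-copy (dec4 x) (E r) (noE (dec≢id x)) (count-other DO allO (≢-sym (inc≢dec x))) alive-own (adj-cross (O (x ∷ r))))
        where
        alive-own : Alive cf (O (x ∷ r))
        alive-own = aliveO-empty r (count-other DO allO (≢-sym (inc≢id x)))
      all-dead : ¬ Alive cf (O (inc4 x ∷ r)) → ¬ (∃[ s ] HAdj (E r) (O s) × Alive cf (O (x ∷ s))) →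
                 ∀ e → HAdj (E (x ∷ r)) e → Dead cf e
      all-dead dead-W none e h with nbr-lift x (E r) e h
      ... | inj₂ refl = not-alive cf (O (inc4 x ∷ r)) dead-W
      ... | inj₁ (O s , refl , h') = not-alive cf (O (x ∷ s)) λ alive-s → none (s , h' , alive-s)
      ... | inj₁ (E s , refl , ())

  module FullOdd (x : Fin 4) (allO : AllHead x DO) where
    noO : ∀ {y} → y ≢ x → nO y ≡ 0
    noO = count-other DO allO

    reach-even : ∀ r → Alive cf (E (x ∷ r)) → ¬ Isolated cf (E (x ∷ r)) → ¬ ¬ ReachesRegular (E (x ∷ r))
    reach-even r alive ¬iso = ¬¬-excluded-middle {A = Good (inc4 x)} >>= λ
      { (yes good) → pure (inc4 x , O r , regular (O r) good alive-W (no-deadO-not-heavy (noO (inc≢id x))) ,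
                           walk-edge alive (adj-cross (E (x ∷ r))) alive-W)
      ; (no ¬good) → via-empty-copies (bad-without-deadO ¬good (noO (inc≢id x))) }
      where
      alive-W : Alive cf (O (inc4 x ∷ r))
      alive-W = aliveO-empty r (noO (inc≢id x))
      via-empty-copies : AllHead (inc4 x) DE → ¬ ¬ ReachesRegular (E (x ∷ r))
      via-empty-copies allE = ¬¬-excluded-middle {A = ∃[ s ] HAdj (E r) (O s) × Alive cf (O (x ∷ s))} >>= λ
        { (yes (s , h , alive-s)) → pure (reach-via {q = O (x ∷ s)} alive (adj-lift x {E r} {O s} h) alive-s
            (into-empty-copy (dec4 x) (E s) (count-other DE allE (≢-sym (inc≢dec x))) (noO (dec≢id x)) alive-s (adj-cross (O (x ∷ s)))))
        ; (no none-inside) → ¬¬-excluded-middle {A = ∃[ p ] HAdj (O (inc4 x ∷ r)) p × p ≢ E (x ∷ r) × Alive cf p} >>= λ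
          { (no none-at-W) → ⊥-elim (¬iso (O (inc4 x ∷ r) , adj-cross (E (x ∷ r)) , alive-W ,
                                            inside-dead none-inside , at-W-dead none-at-W))
          ; (yes (p , h , p≢ , alive-p)) → pure (beyond-W p h p≢ alive-p) } }
        where
        inside-dead : ¬ (∃[ s ] HAdj (E r) (O s) × Alive cf (O (x ∷ s))) →
                      ∀ e → HAdj (E (x ∷ r)) e → e ≢ O (inc4 x ∷ r) → Dead cf e
        inside-dead none e h e≢W with nbr-lift x (E r) e h
        ... | inj₂ e≡W = ⊥-elim (e≢W e≡W)
        ... | inj₁ (O s , refl , h') = not-alive cf (O (x ∷ s)) λ alive-s → none (s , h' , alive-s)
        ... | inj₁ (E s , refl , ())
        at-W-dead : ¬ (∃[ p ] HAdj (O (inc4 x ∷ r)) p × p ≢ E (x ∷ r) × Alive cf p) →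
                    ∀ e → HAdj (O (inc4 x ∷ r)) e → e ≢ E (x ∷ r) → Dead cf e
        at-W-dead none e h e≢ = not-alive cf e λ alive-e → none (e , h , e≢ , alive-e)
        beyond-W : ∀ p → HAdj (O (inc4 x ∷ r)) p → p ≢ E (x ∷ r) → Alive cf p → ReachesRegular (E (x ∷ r))
        beyond-W p h p≢ alive-p with nbr-lift (inc4 x) (O r) p h
        ... | inj₂ refl = ⊥-elim (p≢ (cong (λ z → E (z ∷ r)) (dec-inc x)))
        ... | inj₁ (O u , refl , ())
        ... | inj₁ (E u , refl , _) = reach-via {q = O (inc4 x ∷ r)} alive (adj-cross (E (x ∷ r))) alive-W (reach-via {q = E (inc4 x ∷ u)} alive-W h alive-p
                (into-empty-copy (inc4 (inc4 x)) (O u) (count-other DE allE (inc≢id (inc4 x))) (noO (inc²≢id x)) alive-p (adj-cross (E (inc4 x ∷ u)))))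

    reach-odd : ∀ s → Alive cf (O (x ∷ s)) → ¬ Isolated cf (O (x ∷ s)) → ¬ ¬ ReachesRegular (O (x ∷ s))
    reach-odd s alive ¬iso = ¬¬-excluded-middle {A = Alive cf (E (dec4 x ∷ s))} >>= λ
      { (yes alive-W) → ¬¬-excluded-middle {A = Good (dec4 x)} >>= λ
          { (yes good) → pure (dec4 x , E s , regular (E s) good alive-W (no-deadO-not-heavy (noO (dec≢id x))) ,
                               walk-edge alive (adj-cross (O (x ∷ s))) alive-W)
          ; (no ¬good) → pure (via-own-even (bad-without-deadO ¬good (noO (dec≢id x)))) }
      ; (no dead-W) → ¬¬-excluded-middle {A = ∃[ t ] HAdj (O s) (E t) × Alive cf (E (x ∷ t))} >>= λ
          { (yes (t , h , alive-t)) →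
              reach-even t alive-t (two-neighbours-not-isolated (HAdj-sym {c = O (x ∷ s)} {E (x ∷ t)} (adj-lift x {O s} {E t} h)) alive
                                      (adj-cross (E (x ∷ t))) (aliveO-empty t (noO (inc≢id x))) (O-heads≢ (≢-sym (inc≢id x)))) >>= λ R →
              pure (reach-via {q = E (x ∷ t)} alive (adj-lift x {O s} {E t} h) alive-t R)
          ; (no none-inside) → ⊥-elim (<⇒≱ (s≤s ≤-refl) (≤-trans (all-neighbours-dead (O (x ∷ s)) (all-dead dead-W none-inside)) DE≤)) } }
      where
      via-own-even : AllHead (dec4 x) DE → ReachesRegular (O (x ∷ s))
      via-own-even allE = reach-via {q = E (x ∷ s)} alive (inj₁ refl) alive-own
        (into-empty-copy (inc4 x) (O s) (count-other DE allE (inc≢dec x)) (noO (inc≢id x)) alive-own (adj-cross (E (x ∷ s))))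
        where
        alive-own : Alive cf (E (x ∷ s))
        alive-own = aliveE-empty s (count-other DE allE (≢-sym (dec≢id x)))
      all-dead : ¬ Alive cf (E (dec4 x ∷ s)) → ¬ (∃[ t ] HAdj (O s) (E t) × Alive cf (E (x ∷ t))) →
                 ∀ e → HAdj (O (x ∷ s)) e → Dead cf e
      all-dead dead-W none e h with nbr-lift x (O s) e h
      ... | inj₂ refl = not-alive cf (E (dec4 x ∷ s)) dead-W
      ... | inj₁ (E t , refl , h') = not-alive cf (E (x ∷ t)) λ alive-t → none (t , h' , alive-t)
      ... | inj₁ (O t , refl , ())

  private
    rest≤1 : ∀ {m n} → k ≤ m → m + n ≤ suc k → n ≤ 1
    rest≤1 {m} {n} k≤m le = +-cancelˡ-≤ k n 1 (subst (k + n ≤_) (+-comm 1 k) (≤-trans (+-monoˡ-≤ n k≤m) le))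

    rest≡0 : ∀ {m m' n} → k ≤ m → k ≤ m' → m + m' + n ≤ suc k → n ≡ 0
    rest≡0 {m} {m'} {n} k≤m k≤m' le = nothing-left k n 1≤k
      (+-cancelˡ-≤ k (k + n) 1 (subst (_≤ k + 1) (+-assoc k k n)
        (subst (k + k + n ≤_) (+-comm 1 k) (≤-trans (+-monoˡ-≤ n (+-mono-≤ k≤m k≤m')) le))))
      where
      nothing-left : ∀ k n → 1 ≤ k → k + n ≤ 1 → n ≡ 0
      nothing-left (suc k) zero _ _ = refl
      nothing-left (suc k) (suc n) _ (s≤s le) = ⊥-elim (<⇒≱ (s≤s z≤n) (subst (_≤ 0) (+-suc k n) le))

  good-beside-heavy : ∀ {x y} → Heavy x → y ≢ x → Good y
  good-beside-heavy heavy y≢x =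
    ≤-trans (rest≤1 (proj₁ (heavy-bound heavy)) (≤-trans (count-two DE (≢-sym y≢x)) DE≤)) 1≤k ,
    ≤-trans (rest≤1 (proj₂ (heavy-bound heavy)) (≤-trans (count-two DO (≢-sym y≢x)) DO≤)) 1≤k

  empty-beside-two-heavy : ∀ {x y z} → Heavy x → Heavy y → x ≢ y → x ≢ z → y ≢ z → nE z ≡ 0 × nO z ≡ 0
  empty-beside-two-heavy heavy-x heavy-y x≢y x≢z y≢z =
    rest≡0 (proj₁ (heavy-bound heavy-x)) (proj₁ (heavy-bound heavy-y)) (≤-trans (count-three DE x≢y x≢z y≢z) DE≤) ,
    rest≡0 (proj₂ (heavy-bound heavy-x)) (proj₂ (heavy-bound heavy-y)) (≤-trans (count-three DO x≢y x≢z y≢z) DO≤)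

  land-either : ∀ {c x} y₁ y₂ (a₁ a₂ : Class k) → y₁ ≢ x → y₂ ≢ x → y₁ ≢ y₂ → Heavy x →
    (Alive cf (lift y₁ a₁) → Walk cf c (lift y₁ a₁)) → (Alive cf (lift y₂ a₂) → Walk cf c (lift y₂ a₂)) →
    Alive cf (lift y₁ a₁) ⊎ Alive cf (lift y₂ a₂) → ¬ ¬ ReachesRegular c
  land-either y₁ y₂ a₁ a₂ y₁≢x y₂≢x y₁≢y₂ heavy walk₁ walk₂ (inj₁ alive₁) = ¬¬-excluded-middle {A = IsolatedIn y₁ a₁} >>= λ
    { (no ¬iso) → pure (y₁ , a₁ , (good-beside-heavy heavy y₁≢x , lift-alive cf y₁ a₁ alive₁ , ¬iso) , walk₁ alive₁)
    ; (yes iso) → let (noE , noO) = empty-beside-two-heavy heavy (a₁ , iso) (≢-sym y₁≢x) (≢-sym y₂≢x) y₁≢y₂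
                  in pure (y₂ , a₂ , regular-empty-copy noE noO a₂ , walk₂ (alive-empty-copy noE noO a₂)) }
  land-either y₁ y₂ a₁ a₂ y₁≢x y₂≢x y₁≢y₂ heavy walk₁ walk₂ (inj₂ alive₂) = ¬¬-excluded-middle {A = IsolatedIn y₂ a₂} >>= λ
    { (no ¬iso) → pure (y₂ , a₂ , (good-beside-heavy heavy y₂≢x , lift-alive cf y₂ a₂ alive₂ , ¬iso) , walk₂ alive₂)
    ; (yes iso) → let (noE , noO) = empty-beside-two-heavy heavy (a₂ , iso) (≢-sym y₂≢x) (≢-sym y₁≢x) (≢-sym y₁≢y₂)
                  in pure (y₁ , a₁ , regular-empty-copy noE noO a₁ , walk₁ (alive-empty-copy noE noO a₁)) }

  -- From a good copy: a class is regular, or lies on an edge isolated in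
  -- its copy but not in H_(k+1), which it leaves by a cross edge.
  reach-from-good : ∀ x a → Good x → Alive cf (lift x a) → ¬ Isolated cf (lift x a) → ¬ ¬ ReachesRegular (lift x a)
  reach-from-good x a good alive ¬iso = ¬¬-excluded-middle {A = IsolatedIn x a} >>= λ
    { (no ¬iso-in) → pure (x , a , (good , lift-alive cf x a alive , ¬iso-in) , start alive)
    ; (yes iso) → escape a alive iso (isolated-escape cf x a iso ¬iso) }
    where
    escape : ∀ a → Alive cf (lift x a) → (i : IsolatedIn x a) →
             Alive cf (cross (lift x a)) ⊎ Alive cf (cross (lift x (proj₁ i))) → ¬ ¬ ReachesRegular (lift x a)
    escape (E r) alive i@(O s , h , alive-s , _) =
      land-either (inc4 x) (dec4 x) (O r) (E s) (inc≢id x) (dec≢id x) (inc≢dec x) (E r , i)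
        (λ alive₁ → walk-edge alive (adj-cross (E (x ∷ r))) alive₁)
        (λ alive₂ → step {b = O (x ∷ s)} (walk-edge alive (adj-lift x {E r} {O s} h) (alive-lift cf x (O s) alive-s)) (adj-cross (O (x ∷ s))) alive₂)
    escape (O r) alive i@(E s , h , alive-s , _) =
      land-either (dec4 x) (inc4 x) (E r) (O s) (dec≢id x) (inc≢id x) (≢-sym (inc≢dec x)) (O r , i)
        (λ alive₁ → walk-edge alive (adj-cross (O (x ∷ r))) alive₁)
        (λ alive₂ → step {b = E (x ∷ s)} (walk-edge alive (adj-lift x {O r} {E s} h) (alive-lift cf x (E s) alive-s)) (adj-cross (E (x ∷ s))) alive₂)

  reach : ∀ c → Alive cf c → ¬ Isolated cf c → ¬ ¬ ReachesRegular c
  reach (E (x ∷ r)) alive ¬iso = ¬¬-excluded-middle {A = Good x} >>= λ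
    { (yes good) → reach-from-good x (E r) good alive ¬iso
    ; (no ¬good) → [ (λ E≰ → FullEven.reach-even x (overfullE E≰) r alive ¬iso)
                   , (λ O≰ → FullOdd.reach-even x (overfullO O≰) r alive ¬iso) ] (not-good ¬good) }
  reach (O (x ∷ s)) alive ¬iso = ¬¬-excluded-middle {A = Good x} >>= λ
    { (yes good) → reach-from-good x (O s) good alive ¬iso
    ; (no ¬good) → [ (λ E≰ → FullEven.reach-odd x (overfullE E≰) s alive ¬iso)
                   , (λ O≰ → FullOdd.reach-odd x (overfullO O≰) s alive ¬iso) ] (not-good ¬good) }

  connected : ∀ c c' → Alive cf c → Alive cf c' → ¬ Isolated cf c → ¬ Isolated cf c' → ¬ ¬ Walk cf c c'
  connected c c' alive alive' ¬iso ¬iso' =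
    reach c alive ¬iso >>= λ { (y , a , reg-a , p) →
    reach c' alive' ¬iso' >>= λ { (z , b , reg-b , q) →
    all-joined y z a b reg-a reg-b >>= λ m → pure (walk-trans p (walk-trans m (walk-sym q))) } }

-- The base case k = 1.  H_1 is the 8-cycle
--   E a — O a — E (a-1) — O (a-1) — ...,
-- and with at most one dead class of each parity both statements are
-- checked by evaluation over all 25 configurations.
module BaseCase where

  pattern ⟨_⟩ a = a ∷ []

  nbrs-E : ∀ {a} c → HAdj {1} (E ⟨ a ⟩) c → c ≡ O ⟨ a ⟩ ⊎ c ≡ O ⟨ inc4 a ⟩
  nbrs-E (O ⟨ b ⟩) (inj₁ refl) = inj₁ refl
  nbrs-E (O ⟨ b ⟩) (inj₂ (zero , refl)) = inj₂ refl

  nbrs-O : ∀ {b} c → HAdj {1} (O ⟨ b ⟩) c → c ≡ E ⟨ b ⟩ ⊎ c ≡ E ⟨ dec4 b ⟩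
  nbrs-O (E ⟨ a ⟩) (inj₁ refl) = inj₁ refl
  nbrs-O {b} (E ⟨ a ⟩) (inj₂ (zero , e)) =
    inj₂ (cong (λ z → E ⟨ z ⟩) (trans (sym (dec-inc a)) (cong dec4 (sym (Vecₚ.∷-injectiveˡ e)))))

  adj-E-O : ∀ a → HAdj {1} (E ⟨ a ⟩) (O ⟨ a ⟩)
  adj-E-O a = inj₁ refl

  adj-E-Oinc : ∀ a → HAdj {1} (E ⟨ a ⟩) (O ⟨ inc4 a ⟩)
  adj-E-Oinc a = inj₂ (zero , refl)

  adj-O-Edec : ∀ b → HAdj {1} (O ⟨ b ⟩) (E ⟨ dec4 b ⟩)
  adj-O-Edec b = inj₂ (zero , cong ⟨_⟩ (sym (inc-dec b)))

  Oinc≢O : ∀ a → O {1} ⟨ inc4 a ⟩ ≢ O ⟨ a ⟩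
  Oinc≢O a e = inc≢id a (Vecₚ.∷-injectiveˡ (cong tailOf e))

  Edec≢E : ∀ a → E {1} ⟨ dec4 a ⟩ ≢ E ⟨ a ⟩
  Edec≢E a e = dec≢id a (Vecₚ.∷-injectiveˡ (cong tailOf e))

  module _ (cf : Config 1) where

    isDead : Class 1 → Bool
    isDead c = isYes (dead? cf c)

    -- E a is isolated iff its edge to O a or to O (a+1) is; the two
    -- conditions below say exactly which neighbours are alive or dead.
    isolatedB : Class 1 → Bool
    isolatedB (E ⟨ a ⟩) = (not (isDead (O ⟨ a ⟩)) ∧ isDead (O ⟨ inc4 a ⟩) ∧ isDead (E ⟨ dec4 a ⟩))
                        ∨ (not (isDead (O ⟨ inc4 a ⟩)) ∧ isDead (O ⟨ a ⟩) ∧ isDead (E ⟨ inc4 a ⟩))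
    isolatedB (O ⟨ b ⟩) = (not (isDead (E ⟨ b ⟩)) ∧ isDead (E ⟨ dec4 b ⟩) ∧ isDead (O ⟨ inc4 b ⟩))
                        ∨ (not (isDead (E ⟨ dec4 b ⟩)) ∧ isDead (E ⟨ b ⟩) ∧ isDead (O ⟨ dec4 b ⟩))

    private
      dead⇒ : ∀ c → Dead cf c → T (isDead c)
      dead⇒ c = fromWitness {a? = dead? cf c}
      alive⇒ : ∀ c → Alive cf c → T (not (isDead c))
      alive⇒ c = fromWitnessFalse {a? = dead? cf c}
      ⇒dead : ∀ c → T (isDead c) → Dead cf c
      ⇒dead c = toWitness {a? = dead? cf c}
      ⇒alive : ∀ c → T (not (isDead c)) → Alive cf c
      ⇒alive c = toWitnessFalse {a? = dead? cf c}
      and₃ : ∀ {x y z} → T x → T y → T z → T (x ∧ y ∧ z)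
      and₃ tx ty tz = Equivalence.from T-∧ (tx , Equivalence.from T-∧ (ty , tz))
      split₃ : ∀ {x y z} → T (x ∧ y ∧ z) → T x × T y × T z
      split₃ t = let (tx , tyz) = Equivalence.to T-∧ t in tx , Equivalence.to T-∧ tyz

    isolatedB-complete : ∀ c → Isolated cf c → T (isolatedB c)
    isolatedB-complete (E ⟨ a ⟩) (d , h , alive , dead-c , dead-d) with nbrs-E d h
    ... | inj₁ refl = Equivalence.from T-∨ (inj₁ (and₃ (alive⇒ (O ⟨ a ⟩) alive)
        (dead⇒ (O ⟨ inc4 a ⟩) (dead-c _ (adj-E-Oinc a) (Oinc≢O a)))
        (dead⇒ (E ⟨ dec4 a ⟩) (dead-d _ (adj-O-Edec a) (Edec≢E a)))))
    ... | inj₂ refl = Equivalence.from T-∨ (inj₂ (and₃ (alive⇒ (O ⟨ inc4 a ⟩) alive)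
        (dead⇒ (O ⟨ a ⟩) (dead-c _ (adj-E-O a) (≢-sym (Oinc≢O a))))
        (dead⇒ (E ⟨ inc4 a ⟩) (dead-d _ (adj-E-O (inc4 a)) (λ e → Edec≢E (inc4 a) (trans (cong (λ z → E ⟨ z ⟩) (dec-inc a)) (sym e)))))))
    isolatedB-complete (O ⟨ b ⟩) (d , h , alive , dead-c , dead-d) with nbrs-O d h
    ... | inj₁ refl = Equivalence.from T-∨ (inj₁ (and₃ (alive⇒ (E ⟨ b ⟩) alive)
        (dead⇒ (E ⟨ dec4 b ⟩) (dead-c _ (adj-O-Edec b) (Edec≢E b)))
        (dead⇒ (O ⟨ inc4 b ⟩) (dead-d _ (adj-E-Oinc b) (Oinc≢O b)))))
    ... | inj₂ refl = Equivalence.from T-∨ (inj₂ (and₃ (alive⇒ (E ⟨ dec4 b ⟩) alive)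
        (dead⇒ (E ⟨ b ⟩) (dead-c _ (adj-E-O b) (≢-sym (Edec≢E b))))
        (dead⇒ (O ⟨ dec4 b ⟩) (dead-d (O ⟨ dec4 b ⟩) (adj-E-O (dec4 b)) (λ e → Oinc≢O (dec4 b) (trans (cong (λ z → O ⟨ z ⟩) (inc-dec b)) (sym e)))))))

    isolated-by : ∀ {c d n₁ n₂} → HAdj c d → Alive cf d →
      (∀ e → HAdj c e → e ≡ d ⊎ e ≡ n₁) → (∀ e → HAdj d e → e ≡ c ⊎ e ≡ n₂) → Dead cf n₁ → Dead cf n₂ → Isolated cf c
    isolated-by {d = d} h alive nbrs-c nbrs-d dead₁ dead₂ = d , h , alive , others nbrs-c dead₁ , others nbrs-d dead₂
      where
      others : ∀ {a b n} → (∀ e → HAdj a e → e ≡ b ⊎ e ≡ n) → Dead cf n → ∀ e → HAdj a e → e ≢ b → Dead cf e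
      others nbrs dead e h e≢ with nbrs e h
      ... | inj₁ e≡ = ⊥-elim (e≢ e≡)
      ... | inj₂ refl = dead

    isolatedB-sound : ∀ c → T (isolatedB c) → Isolated cf c
    isolatedB-sound (E ⟨ a ⟩) t with Equivalence.to T-∨ t
    ... | inj₁ t₁ = let (al , d₁ , d₂) = split₃ {not (isDead (O ⟨ a ⟩))} {isDead (O ⟨ inc4 a ⟩)} t₁ in
      isolated-by {E ⟨ a ⟩} {O ⟨ a ⟩} {O ⟨ inc4 a ⟩} {E ⟨ dec4 a ⟩} (adj-E-O a) (⇒alive (O ⟨ a ⟩) al)
                  nbrs-E nbrs-O (⇒dead (O ⟨ inc4 a ⟩) d₁) (⇒dead (E ⟨ dec4 a ⟩) d₂)
    ... | inj₂ t₂ = let (al , d₁ , d₂) = split₃ {not (isDead (O ⟨ inc4 a ⟩))} {isDead (O ⟨ a ⟩)} t₂ in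
      isolated-by {E ⟨ a ⟩} {O ⟨ inc4 a ⟩} {O ⟨ a ⟩} {E ⟨ inc4 a ⟩} (adj-E-Oinc a) (⇒alive (O ⟨ inc4 a ⟩) al)
                  (λ e h → [ inj₂ , inj₁ ] (nbrs-E e h))
                  (λ e h → [ inj₂ , (λ e≡ → inj₁ (trans e≡ (cong (λ z → E ⟨ z ⟩) (dec-inc a)))) ] (nbrs-O e h))
                  (⇒dead (O ⟨ a ⟩) d₁) (⇒dead (E ⟨ inc4 a ⟩) d₂)
    isolatedB-sound (O ⟨ b ⟩) t with Equivalence.to T-∨ t
    ... | inj₁ t₁ = let (al , d₁ , d₂) = split₃ {not (isDead (E ⟨ b ⟩))} {isDead (E ⟨ dec4 b ⟩)} t₁ in
      isolated-by {O ⟨ b ⟩} {E ⟨ b ⟩} {E ⟨ dec4 b ⟩} {O ⟨ inc4 b ⟩} (inj₁ refl) (⇒alive (E ⟨ b ⟩) al)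
                  nbrs-O nbrs-E (⇒dead (E ⟨ dec4 b ⟩) d₁) (⇒dead (O ⟨ inc4 b ⟩) d₂)
    ... | inj₂ t₂ = let (al , d₁ , d₂) = split₃ {not (isDead (E ⟨ dec4 b ⟩))} {isDead (E ⟨ b ⟩)} t₂ in
      isolated-by {O ⟨ b ⟩} {E ⟨ dec4 b ⟩} {E ⟨ b ⟩} {O ⟨ dec4 b ⟩} (adj-O-Edec b) (⇒alive (E ⟨ dec4 b ⟩) al)
                  (λ e h → [ inj₂ , inj₁ ] (nbrs-O e h))
                  (λ e h → [ inj₂ , (λ e≡ → inj₁ (trans e≡ (cong (λ z → O ⟨ z ⟩) (inc-dec b)))) ] (nbrs-E e h))
                  (⇒dead (E ⟨ b ⟩) d₁) (⇒dead (O ⟨ dec4 b ⟩) d₂)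

    next : Class 1 → Class 1
    next (E ⟨ a ⟩) = O ⟨ inc4 a ⟩
    next (O ⟨ b ⟩) = E ⟨ b ⟩

    adj-next : ∀ c → HAdj c (next c)
    adj-next (E ⟨ a ⟩) = adj-E-Oinc a
    adj-next (O ⟨ b ⟩) = inj₁ refl

    go-around : ℕ → ∀ {c} cur c' → Walk cf c cur → Maybe (Walk cf c c')
    go-around n cur c' p with cur ≟C c'
    ... | yes refl = just p
    go-around zero cur c' p | no _ = nothing
    go-around (suc n) cur c' p | no _ with dead? cf (next cur)
    ... | yes _ = nothing
    ... | no alive = go-around n (next cur) c' (step p (adj-next cur) alive)

    search : ∀ c c' → Maybe (Walk cf c c')
    search c c' with dead? cf c
    ... | yes _ = nothing
    ... | no alive = go-around 8 c c' (start alive)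

    fine : Class 1 → Class 1 → Bool
    fine c c' = isDead c ∨ isDead c' ∨ isolatedB c ∨ isolatedB c' ∨ is-just (search c c') ∨ is-just (search c' c)

    fine-connected : ∀ c c' → Alive cf c → Alive cf c' → ¬ Isolated cf c → ¬ Isolated cf c' → T (fine c c') → Walk cf c c'
    fine-connected c c' alive alive' ¬iso ¬iso' t with Equivalence.to (T-∨ {isDead c}) t
    ... | inj₁ d = ⊥-elim (alive (⇒dead c d))
    ... | inj₂ t with Equivalence.to (T-∨ {isDead c'}) t
    ... | inj₁ d = ⊥-elim (alive' (⇒dead c' d))
    ... | inj₂ t with Equivalence.to (T-∨ {isolatedB c}) t
    ... | inj₁ i = ⊥-elim (¬iso (isolatedB-sound c i))
    ... | inj₂ t with Equivalence.to (T-∨ {isolatedB c'}) t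
    ... | inj₁ i = ⊥-elim (¬iso' (isolatedB-sound c' i))
    ... | inj₂ t with search c c' | search c' c | Equivalence.to (T-∨ {is-just (search c c')}) t
    ... | just p | _ | inj₁ _ = p
    ... | _ | just q | inj₂ _ = walk-sym q

    sameParityB : Class 1 → Class 1 → Bool
    sameParityB (E _) (E _) = true
    sameParityB (O _) (O _) = true
    sameParityB _ _ = false

    unique-isolatedB : Class 1 → Class 1 → Bool
    unique-isolatedB c c' = not (sameParityB c c' ∧ isolatedB c ∧ isolatedB c') ∨ isYes (c ≟C c')

    unique-isolatedB-sound : ∀ c c' → SameParity c c' → Isolated cf c → Isolated cf c' → T (unique-isolatedB c c') → c ≡ c'
    unique-isolatedB-sound c c' same iso iso' t with Equivalence.to (T-∨ {not (sameParityB c c' ∧ isolatedB c ∧ isolatedB c')}) t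
    ... | inj₂ eq = toWitness eq
    ... | inj₁ not-all = ⊥-elim (not-all-true (same-parity same) (isolatedB-complete c iso) (isolatedB-complete c' iso') not-all)
      where
      same-parity : ∀ {c c'} → SameParity c c' → T (sameParityB c c')
      same-parity even = tt
      same-parity odd = tt
      not-all-true : ∀ {x y z} → T x → T y → T z → ¬ T (not (x ∧ y ∧ z))
      not-all-true {true} {true} {true} _ _ _ ()

  configOf : Maybe (Fin 4) → Maybe (Fin 4) → Config 1
  configOf mE mO = config (toList mE) (toList mO)
    where
    toList : Maybe (Fin 4) → List (Tail 1)
    toList nothing = []
    toList (just a) = ⟨ a ⟩ ∷ []

  small-config : ∀ (cf : Config 1) → Bounded 1 cf → ∃[ mE ] ∃[ mO ] cf ≡ configOf mE mO
  small-config (config [] []) _ = nothing , nothing , refl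
  small-config (config [] (⟨ b ⟩ ∷ [])) _ = nothing , just b , refl
  small-config (config (⟨ a ⟩ ∷ []) []) _ = just a , nothing , refl
  small-config (config (⟨ a ⟩ ∷ []) (⟨ b ⟩ ∷ [])) _ = just a , just b , refl
  small-config (config (_ ∷ _ ∷ _) _) (s≤s () , _)
  small-config (config _ (_ ∷ _ ∷ _)) (_ , s≤s ())

  all-Fin4 : (Fin 4 → Bool) → Bool
  all-Fin4 f = f zero ∧ f (suc zero) ∧ f (suc (suc zero)) ∧ f (suc (suc (suc zero)))

  all-Fin4-sound : ∀ f → T (all-Fin4 f) → ∀ x → T (f x)
  all-Fin4-sound f t x with Equivalence.to (T-∧ {f zero}) t
  all-Fin4-sound f t zero | t₀ , _ = t₀
  all-Fin4-sound f t (suc x) | _ , t' with Equivalence.to (T-∧ {f (suc zero)}) t'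
  all-Fin4-sound f t (suc zero) | _ , _ | t₁ , _ = t₁
  all-Fin4-sound f t (suc (suc x)) | _ , _ | _ , t'' with Equivalence.to (T-∧ {f (suc (suc zero))}) t''
  all-Fin4-sound f t (suc (suc zero)) | _ , _ | _ , _ | t₂ , _ = t₂
  all-Fin4-sound f t (suc (suc (suc zero))) | _ , _ | _ , _ | _ , t₃ = t₃

  all-Maybe : (Maybe (Fin 4) → Bool) → Bool
  all-Maybe f = f nothing ∧ all-Fin4 (f ∘ just)

  all-Maybe-sound : ∀ f → T (all-Maybe f) → ∀ m → T (f m)
  all-Maybe-sound f t nothing = proj₁ (Equivalence.to (T-∧ {f nothing}) t)
  all-Maybe-sound f t (just a) = all-Fin4-sound (f ∘ just) (proj₂ (Equivalence.to (T-∧ {f nothing}) t)) a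

  all-Class : (Class 1 → Bool) → Bool
  all-Class f = all-Fin4 (λ a → f (E ⟨ a ⟩)) ∧ all-Fin4 (λ a → f (O ⟨ a ⟩))

  all-Class-sound : ∀ f → T (all-Class f) → ∀ c → T (f c)
  all-Class-sound f t (E ⟨ a ⟩) = all-Fin4-sound (λ a → f (E ⟨ a ⟩)) (proj₁ (Equivalence.to (T-∧ {all-Fin4 (λ a → f (E ⟨ a ⟩))}) t)) a
  all-Class-sound f t (O ⟨ a ⟩) = all-Fin4-sound (λ a → f (O ⟨ a ⟩)) (proj₂ (Equivalence.to (T-∧ {all-Fin4 (λ a → f (E ⟨ a ⟩))}) t)) a

  for-all-pairs : (Config 1 → Class 1 → Class 1 → Bool) → Bool
  for-all-pairs f = all-Maybe λ mE → all-Maybe λ mO → all-Class λ c → all-Class λ c' → f (configOf mE mO) c c'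

  for-all-pairs-sound : ∀ f → T (for-all-pairs f) → ∀ mE mO c c' → T (f (configOf mE mO) c c')
  for-all-pairs-sound f t mE mO c c' =
    all-Class-sound (f (configOf mE mO) c) (all-Class-sound (λ c → all-Class (f (configOf mE mO) c))
      (all-Maybe-sound (λ mO → all-Class λ c → all-Class (f (configOf mE mO) c))
        (all-Maybe-sound (λ mE → all-Maybe λ mO → all-Class λ c → all-Class (f (configOf mE mO) c)) t mE) mO) c) c'

  base-connected : CoreConnected 1
  base-connected cf bounded c c' alive alive' ¬iso ¬iso' with small-config cf bounded
  ... | mE , mO , refl = pure (fine-connected (configOf mE mO) c c' alive alive' ¬iso ¬iso'
                                 (for-all-pairs-sound fine checked mE mO c c'))
    where
    checked : T (for-all-pairs fine)
    checked = tt

  base-unique : UniqueIsolated 1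
  base-unique cf bounded {c} {c'} same iso iso' with small-config cf bounded
  ... | mE , mO , refl = unique-isolatedB-sound (configOf mE mO) c c' same iso iso'
                           (for-all-pairs-sound unique-isolatedB checked mE mO c c')
    where
    checked : T (for-all-pairs unique-isolatedB)
    checked = tt

core : ∀ k → CoreConnected (suc k) × UniqueIsolated (suc k)
core zero = BaseCase.base-connected , BaseCase.base-unique
core (suc k) = Step.connected (suc k) (s≤s z≤n) (proj₁ (core k)) (proj₂ (core k)) , unique-for-2≤k
  where
  unique-for-2≤k : UniqueIsolated (suc (suc k))
  unique-for-2≤k cf bounded {c} same iso iso' = isolated-unique (s≤s (s≤s z≤n)) same (bounded-opposite bounded c) iso iso'

module Vertices {K : ℕ} where

  V : Set
  V = Vertex (suc K)

  classOf : V → Class K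
  classOf (zero ∷ t) = E t
  classOf (suc zero ∷ t) = O t
  classOf (suc (suc zero) ∷ t) = E t
  classOf (suc (suc (suc zero)) ∷ t) = O t

  twin₀ twin₁ : Class K → V
  twin₀ (E t) = zero ∷ t
  twin₀ (O t) = suc zero ∷ t
  twin₁ (E t) = suc (suc zero) ∷ t
  twin₁ (O t) = suc (suc (suc zero)) ∷ t

  classOf-twin₀ : ∀ c → classOf (twin₀ c) ≡ c
  classOf-twin₀ (E t) = refl
  classOf-twin₀ (O t) = refl

  classOf-twin₁ : ∀ c → classOf (twin₁ c) ≡ c
  classOf-twin₁ (E t) = refl
  classOf-twin₁ (O t) = refl

  twin-cases : ∀ u → u ≡ twin₀ (classOf u) ⊎ u ≡ twin₁ (classOf u)
  twin-cases (zero ∷ t) = inj₁ refl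
  twin-cases (suc zero ∷ t) = inj₁ refl
  twin-cases (suc (suc zero) ∷ t) = inj₂ refl
  twin-cases (suc (suc (suc zero)) ∷ t) = inj₂ refl

  twin₀≢twin₁ : ∀ c c' → twin₀ c ≢ twin₁ c'
  twin₀≢twin₁ (E _) (E _) ()
  twin₀≢twin₁ (E _) (O _) ()
  twin₀≢twin₁ (O _) (E _) ()
  twin₀≢twin₁ (O _) (O _) ()

  private
    unshift-edge : ∀ {as bs : Tail K} → (bs ≡ as ⊎ ∃[ i ] bs ≡ as [ i ]%= dec4) → bs ▹ as
    unshift-edge (inj₁ e) = inj₁ (sym e)
    unshift-edge {as} (inj₂ (i , e)) = inj₂ (i , trans (sym (shift-unshift (just i) as)) (cong (shift (just i)) (sym e)))

    shift-edge : ∀ {as bs : Tail K} → as ▹ bs → (as ≡ bs ⊎ ∃[ i ] as ≡ bs [ i ]%= dec4)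
    shift-edge (inj₁ e) = inj₁ (sym e)
    shift-edge {as} {bs} (inj₂ (i , e)) = inj₂ (i , trans (sym (unshift-shift (just i) as)) (cong (unshift (just i)) (sym e)))

  adj-classOf : ∀ {u v : V} → Adj u v → HAdj (classOf u) (classOf v)
  adj-classOf {zero ∷ _} {.(suc zero) ∷ _} (inj₁ refl , h) = h
  adj-classOf {zero ∷ _} {.(suc (suc (suc zero))) ∷ _} (inj₂ refl , h) = h
  adj-classOf {suc (suc zero) ∷ _} {.(suc (suc (suc zero))) ∷ _} (inj₁ refl , h) = h
  adj-classOf {suc (suc zero) ∷ _} {.(suc zero) ∷ _} (inj₂ refl , h) = h
  adj-classOf {suc zero ∷ _} {.(suc (suc zero)) ∷ _} (inj₁ refl , h) = unshift-edge h
  adj-classOf {suc zero ∷ _} {.zero ∷ _} (inj₂ refl , h) = unshift-edge h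
  adj-classOf {suc (suc (suc zero)) ∷ _} {.zero ∷ _} (inj₁ refl , h) = unshift-edge h
  adj-classOf {suc (suc (suc zero)) ∷ _} {.(suc (suc zero)) ∷ _} (inj₂ refl , h) = unshift-edge h

  classOf-adj : ∀ (u v : V) → HAdj (classOf u) (classOf v) → Adj u v
  classOf-adj (zero ∷ _) (suc zero ∷ _) h = inj₁ refl , h
  classOf-adj (zero ∷ _) (suc (suc (suc zero)) ∷ _) h = inj₂ refl , h
  classOf-adj (suc (suc zero) ∷ _) (suc zero ∷ _) h = inj₂ refl , h
  classOf-adj (suc (suc zero) ∷ _) (suc (suc (suc zero)) ∷ _) h = inj₁ refl , h
  classOf-adj (suc zero ∷ _) (zero ∷ _) h = inj₂ refl , shift-edge h
  classOf-adj (suc zero ∷ _) (suc (suc zero) ∷ _) h = inj₁ refl , shift-edge h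
  classOf-adj (suc (suc (suc zero)) ∷ _) (zero ∷ _) h = inj₁ refl , shift-edge h
  classOf-adj (suc (suc (suc zero)) ∷ _) (suc (suc zero) ∷ _) h = inj₂ refl , shift-edge h
  classOf-adj (zero ∷ _) (zero ∷ _) ()
  classOf-adj (zero ∷ _) (suc (suc zero) ∷ _) ()
  classOf-adj (suc (suc zero) ∷ _) (zero ∷ _) ()
  classOf-adj (suc (suc zero) ∷ _) (suc (suc zero) ∷ _) ()
  classOf-adj (suc zero ∷ _) (suc zero ∷ _) ()
  classOf-adj (suc zero ∷ _) (suc (suc (suc zero)) ∷ _) ()
  classOf-adj (suc (suc (suc zero)) ∷ _) (suc zero ∷ _) ()
  classOf-adj (suc (suc (suc zero)) ∷ _) (suc (suc (suc zero)) ∷ _) ()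

  Adj-sym : ∀ {u v : V} → Adj u v → Adj v u
  Adj-sym {u} {v} h = classOf-adj v u (HAdj-sym (adj-classOf h))

  isEven : Class K → Bool
  isEven (E _) = true
  isEven (O _) = false

  parity : V → Bool
  parity u = isEven (classOf u)

  parity-adj : ∀ {u v : V} → Adj u v → parity v ≡ not (parity u)
  parity-adj {u} {v} h with classOf u | classOf v | adj-classOf h
  ... | E _ | O _ | _ = refl
  ... | O _ | E _ | _ = refl

  module _ (q : C4 (suc K)) where
    open C4 q

    private
      parity₂ : parity v2 ≡ parity v0
      parity₂ = trans (parity-adj e12) (trans (cong not (parity-adj e01)) (not-involutive (parity v0)))
      parity₃ : parity v3 ≡ parity v1
      parity₃ = trans (parity-adj e23) (trans (cong not parity₂) (sym (parity-adj e01)))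
      parity₁ : parity v1 ≢ parity v0
      parity₁ e = not-¬ refl (trans (sym e) (parity-adj e01))

    withParity : Bool → List V
    withParity b with parity v0 ≟B b
    ... | yes _ = v0 ∷ v2 ∷ []
    ... | no _ = v1 ∷ v3 ∷ []

    length-withParity : ∀ b → length (withParity b) ≡ 2
    length-withParity b with parity v0 ≟B b
    ... | yes _ = refl
    ... | no _ = refl

    ∈-withParity : ∀ {x} → InC4 x q → x ∈ withParity (parity x)
    ∈-withParity (inj₁ refl) with parity v0 ≟B parity v0
    ... | yes _ = here refl
    ... | no ≢ = ⊥-elim (≢ refl)
    ∈-withParity (inj₂ (inj₁ refl)) with parity v0 ≟B parity v1
    ... | yes e = ⊥-elim (parity₁ (sym e))
    ... | no _ = here refl
    ∈-withParity (inj₂ (inj₂ (inj₁ refl))) with parity v0 ≟B parity v2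
    ... | yes _ = there (here refl)
    ... | no ≢ = ⊥-elim (≢ (sym parity₂))
    ∈-withParity (inj₂ (inj₂ (inj₂ refl))) with parity v0 ≟B parity v3
    ... | yes e = ⊥-elim (parity₁ (trans (sym parity₃) (sym e)))
    ... | no _ = there (here refl)

    C4-adj : ∀ {x y} → InC4 x q → InC4 y q → parity x ≢ parity y → Adj x y
    C4-adj (inj₁ refl) (inj₂ (inj₁ refl)) _ = e01
    C4-adj (inj₁ refl) (inj₂ (inj₂ (inj₂ refl))) _ = Adj-sym e30
    C4-adj (inj₂ (inj₁ refl)) (inj₁ refl) _ = Adj-sym e01
    C4-adj (inj₂ (inj₁ refl)) (inj₂ (inj₂ (inj₁ refl))) _ = e12
    C4-adj (inj₂ (inj₂ (inj₁ refl))) (inj₂ (inj₁ refl)) _ = Adj-sym e12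
    C4-adj (inj₂ (inj₂ (inj₁ refl))) (inj₂ (inj₂ (inj₂ refl))) _ = e23
    C4-adj (inj₂ (inj₂ (inj₂ refl))) (inj₁ refl) _ = e30
    C4-adj (inj₂ (inj₂ (inj₂ refl))) (inj₂ (inj₂ (inj₁ refl))) _ = Adj-sym e23
    C4-adj (inj₁ refl) (inj₁ refl) ≢ = ⊥-elim (≢ refl)
    C4-adj (inj₁ refl) (inj₂ (inj₂ (inj₁ refl))) ≢ = ⊥-elim (≢ (sym parity₂))
    C4-adj (inj₂ (inj₁ refl)) (inj₂ (inj₁ refl)) ≢ = ⊥-elim (≢ refl)
    C4-adj (inj₂ (inj₁ refl)) (inj₂ (inj₂ (inj₂ refl))) ≢ = ⊥-elim (≢ (sym parity₃))
    C4-adj (inj₂ (inj₂ (inj₁ refl))) (inj₁ refl) ≢ = ⊥-elim (≢ parity₂)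
    C4-adj (inj₂ (inj₂ (inj₁ refl))) (inj₂ (inj₂ (inj₁ refl))) ≢ = ⊥-elim (≢ refl)
    C4-adj (inj₂ (inj₂ (inj₂ refl))) (inj₂ (inj₁ refl)) ≢ = ⊥-elim (≢ parity₃)
    C4-adj (inj₂ (inj₂ (inj₂ refl))) (inj₂ (inj₂ (inj₂ refl))) ≢ = ⊥-elim (≢ refl)

  InC4? : ∀ x q → Dec (InC4 {suc K} x q)
  InC4? x q = x ≟V C4.v0 q ⊎-dec (x ≟V C4.v1 q ⊎-dec (x ≟V C4.v2 q ⊎-dec x ≟V C4.v3 q))
    where
    _≟V_ = _≟T_

  InV? : ∀ x F → Dec (InV {suc K} x F)
  InV? x F = any? (InC4? x) F

no-triangle : ∀ {K} {c d p : Class K} → HAdj c d → HAdj c p → HAdj d p → ⊥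
no-triangle {c = E _} {O _} {O _} _ _ ()
no-triangle {c = E _} {O _} {E _} _ ()
no-triangle {c = O _} {E _} {E _} _ _ ()
no-triangle {c = O _} {E _} {O _} _ ()
no-triangle {c = E _} {E _} ()
no-triangle {c = O _} {O _} ()

length-concatMap-2 : ∀ {A B : Set} (f : A → List B) → (∀ x → length (f x) ≡ 2) → ∀ xs → length (concatMap f xs) ≡ 2 * length xs
length-concatMap-2 f two [] = refl
length-concatMap-2 f two (x ∷ xs) = begin
  length (f x ++ concatMap f xs)         ≡⟨ length-++ (f x) ⟩
  length (f x) + length (concatMap f xs) ≡⟨ cong₂ _+_ (two x) (length-concatMap-2 f two xs) ⟩
  2 + 2 * length xs                      ≡⟨ sym (*-suc 2 (length xs)) ⟩
  2 * length (x ∷ xs)                    ∎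
  where open ≡-Reasoning

module CutConfig {K : ℕ} (F : List (C4 (suc K))) where
  open Vertices {K}

  DeadFor : Class K → Set
  DeadFor c = InV (twin₀ c) F × InV (twin₁ c) F

  DeadFor? : ∀ c → Dec (DeadFor c)
  DeadFor? c = InV? (twin₀ c) F ×-dec InV? (twin₁ c) F

  deadTails : (Tail K → Class K) → List (Tail K)
  deadTails cl = filter (DeadFor? ∘ cl) (allTails K)

  deadTails⁻ : ∀ cl {t} → t ∈ deadTails cl → DeadFor (cl t)
  deadTails⁻ cl t∈ = proj₂ (∈-filter⁻ (DeadFor? ∘ cl) {xs = allTails K} t∈)

  configFor : Config K
  configFor = config (deadTails E) (deadTails O)

  dead-sound : ∀ c → Dead configFor c → DeadFor c
  dead-sound (E t) = deadTails⁻ E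
  dead-sound (O t) = deadTails⁻ O

  dead-complete : ∀ c → DeadFor c → Dead configFor c
  dead-complete (E t) = ∈-filter⁺ (DeadFor? ∘ E) (allTails-complete t)
  dead-complete (O t) = ∈-filter⁺ (DeadFor? ∘ O) (allTails-complete t)

  twins : List (Class K) → List V
  twins cs = map twin₀ cs ++ map twin₁ cs

  twins-unique : ∀ {cs} → Unique cs → Unique (twins cs)
  twins-unique u = Uniqueₚ.++⁺ (Uniqueₚ.map⁺ (injective classOf-twin₀) u) (Uniqueₚ.map⁺ (injective classOf-twin₁) u) disjoint
    where
    injective : ∀ {tw : Class K → V} → (∀ c → classOf (tw c) ≡ c) → ∀ {c c'} → tw c ≡ tw c' → c ≡ c'
    injective inv {c} {c'} e = trans (sym (inv c)) (trans (cong classOf e) (inv c'))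
    disjoint : ∀ {v} → ¬ (v ∈ map twin₀ _ × v ∈ map twin₁ _)
    disjoint (v∈₀ , v∈₁) with ∈-map⁻ twin₀ v∈₀ | ∈-map⁻ twin₁ v∈₁
    ... | c , _ , refl | c' , _ , e = twin₀≢twin₁ c c' e

  length-twins : ∀ cs → length (twins cs) ≡ 2 * length cs
  length-twins cs = trans (length-++ (map twin₀ cs))
    (trans (cong₂ _+_ (length-map twin₀ cs) (length-map twin₁ cs)) (cong (length cs +_) (sym (+-identityʳ (length cs)))))

  ∈-twins : ∀ {cs v} → v ∈ twins cs → ∃[ c ] c ∈ cs × (v ≡ twin₀ c ⊎ v ≡ twin₁ c)
  ∈-twins {cs} v∈ with ∈-++⁻ (map twin₀ cs) v∈
  ... | inj₁ v∈₀ = let (c , c∈ , e) = ∈-map⁻ twin₀ v∈₀ in c , c∈ , inj₁ e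
  ... | inj₂ v∈₁ = let (c , c∈ , e) = ∈-map⁻ twin₁ v∈₁ in c , c∈ , inj₂ e

  twin-class : ∀ {cs v} → v ∈ twins cs → classOf v ∈ cs
  twin-class {cs} v∈ with ∈-twins v∈
  ... | c , c∈ , inj₁ refl = subst (_∈ cs) (sym (classOf-twin₀ c)) c∈
  ... | c , c∈ , inj₂ refl = subst (_∈ cs) (sym (classOf-twin₁ c)) c∈

  -- The counting lemma: there are at most |F| pairwise non-adjacent dead
  -- classes.  Their twins are 2|cs| distinct vertices of V(F); two of them
  -- on one 4-cycle have the same parity (else they would be adjacent), so
  -- each 4-cycle carries at most the two vertices of one parity.
  module Independent {cs : List (Class K)} (unique : Unique cs) (dead : ∀ {c} → c ∈ cs → DeadFor c)
                     (independent : ∀ {p q} → p ∈ cs → q ∈ cs → ¬ HAdj p q) where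

    in-F : ∀ {v} → v ∈ twins cs → InV v F
    in-F v∈ with ∈-twins v∈
    ... | c , c∈ , inj₁ refl = proj₁ (dead c∈)
    ... | c , c∈ , inj₂ refl = proj₂ (dead c∈)

    same-parity : ∀ {x y} q → x ∈ twins cs → y ∈ twins cs → InC4 x q → InC4 y q → parity y ≡ parity x
    same-parity {x} {y} q x∈ y∈ x∈q y∈q with parity y ≟B parity x
    ... | yes eq = eq
    ... | no ≢ = ⊥-elim (independent (twin-class x∈) (twin-class y∈) (adj-classOf (C4-adj q x∈q y∈q (≢-sym ≢))))

    -- on each 4-cycle, the two vertices of the parity of its vertices in twins cs
    side : C4 (suc K) → List V
    side q with any? (λ x → InC4? x q) (twins cs)
    ... | yes some = withParity q (parity (proj₁ (find some)))
    ... | no _ = withParity q true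

    length-side : ∀ q → length (side q) ≡ 2
    length-side q with any? (λ x → InC4? x q) (twins cs)
    ... | yes some = length-withParity q _
    ... | no _ = length-withParity q true

    ∈-side : ∀ {x} q → x ∈ twins cs → InC4 x q → x ∈ side q
    ∈-side {x} q x∈ x∈q with any? (λ x → InC4? x q) (twins cs)
    ... | yes some = let (y , y∈ , y∈q) = find some in
      subst (λ b → x ∈ withParity q b) (same-parity q y∈ x∈ y∈q x∈q) (∈-withParity q x∈q)
    ... | no none = ⊥-elim (none (lose x∈ x∈q))

    bound : length cs ≤ length F
    bound = *-cancelˡ-≤ 2 (begin
      2 * length cs                ≡⟨ sym (length-twins cs) ⟩
      length (twins cs)            ≤⟨ unique-length (twins-unique unique) twins⊆ ⟩
      length (concatMap side F)    ≡⟨ length-concatMap-2 side length-side F ⟩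
      2 * length F                 ∎)
      where
      open ≤-Reasoning
      twins⊆ : twins cs ⊆ concatMap side F
      twins⊆ {x} x∈ = ∈-concatMap⁺ side (Any.map (λ {q} → ∈-side q x∈) (in-F x∈))

  -- Dead classes of one parity are pairwise non-adjacent, so at most |F|.
  few-dead : ∀ (cl : Tail K → Class K) → (∀ {t t'} → cl t ≡ cl t' → t ≡ t') → (∀ {t t'} → ¬ HAdj (cl t) (cl t')) →
             length (deadTails cl) ≤ length F
  few-dead cl cl-injective same-side = subst (_≤ length F) (length-map cl (deadTails cl))
    (Independent.bound (Uniqueₚ.map⁺ cl-injective (Uniqueₚ.filter⁺ (DeadFor? ∘ cl) (allTails-unique K)))
                       dead-in (λ p∈ q∈ → same-class p∈ q∈))
    where
    dead-in : ∀ {c} → c ∈ map cl (deadTails cl) → DeadFor c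
    dead-in c∈ with ∈-map⁻ cl c∈
    ... | t , t∈ , refl = deadTails⁻ cl t∈
    same-class : ∀ {p q} → p ∈ map cl (deadTails cl) → q ∈ map cl (deadTails cl) → ¬ HAdj p q
    same-class p∈ q∈ with ∈-map⁻ cl p∈ | ∈-map⁻ cl q∈
    ... | _ , _ , refl | _ , _ , refl = same-side

  bounded : length F ≤ K → Bounded K configFor
  bounded |F|≤K = ≤-trans (few-dead E (λ { refl → refl }) (λ ())) |F|≤K ,
                  ≤-trans (few-dead O (λ { refl → refl }) (λ ())) |F|≤K

  -- The neighbours of c other than d and those of d other than c: 2K
  -- distinct classes, pairwise non-adjacent because H_K has no triangles
  -- and two classes have at most one common neighbour.
  module EdgeNeighbours {c d : Class K} (c~d : HAdj c d) where

    others : Move K → List (Move K)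
    others a₀ = filter (λ a → ¬? (a ≟M a₀)) (moves K)

    others⁻ : ∀ {a a₀} → a ∈ others a₀ → a ≢ a₀
    others⁻ {a₀ = a₀} a∈ = proj₂ (∈-filter⁻ (λ a → ¬? (a ≟M a₀)) {xs = moves K} a∈)

    others-unique : ∀ a₀ → Unique (others a₀)
    others-unique a₀ = Uniqueₚ.filter⁺ (λ a → ¬? (a ≟M a₀)) (moves-unique K)

    others-length : ∀ a₀ → K ≤ length (others a₀)
    others-length a₀ = count-moves-but-one id id (others a₀) a₀ (λ a a≢a₀ → ∈-filter⁺ (λ a → ¬? (a ≟M a₀)) (moves-complete a) a≢a₀)

    d~c : HAdj d c
    d~c = HAdj-sym {c = c} {d} c~d

    a₀ b₀ : Move K
    a₀ = proj₁ (adj-nbr c~d)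
    b₀ = proj₁ (adj-nbr d~c)

    side-c side-d AB : List (Class K)
    side-c = map (nbr c) (others a₀)
    side-d = map (nbr d) (others b₀)
    AB = side-c ++ side-d

    length-AB : K + K ≤ length AB
    length-AB = ≤-trans (+-mono-≤ (others-length a₀) (others-length b₀))
      (≤-reflexive (sym (trans (length-++ side-c) (cong₂ _+_ (length-map (nbr c) (others a₀)) (length-map (nbr d) (others b₀))))))

    in-side : ∀ {x y b₀ p} → y ≡ nbr x b₀ → p ∈ map (nbr x) (others b₀) → HAdj x p × p ≢ y
    in-side {x} y≡ p∈ with ∈-map⁻ (nbr x) p∈
    ... | b , b∈ , refl = nbr-adj x b , λ e → others⁻ b∈ (nbr-injective x (trans e y≡))

    in-side-c : ∀ {p} → p ∈ side-c → HAdj c p × p ≢ d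
    in-side-c = in-side (proj₂ (adj-nbr c~d))

    in-side-d : ∀ {p} → p ∈ side-d → HAdj d p × p ≢ c
    in-side-d = in-side (proj₂ (adj-nbr d~c))

    AB-unique : Unique AB
    AB-unique = Uniqueₚ.++⁺ (Uniqueₚ.map⁺ (nbr-injective c) (others-unique a₀)) (Uniqueₚ.map⁺ (nbr-injective d) (others-unique b₀))
                           sides-disjoint
      where
      sides-disjoint : ∀ {p} → ¬ (p ∈ side-c × p ∈ side-d)
      sides-disjoint (p∈c , p∈d) = no-triangle c~d (proj₁ (in-side-c p∈c)) (proj₁ (in-side-d p∈d))

    -- p ~ c and q ~ d adjacent would give c and q the common neighbours d and p.
    cross-independent : ∀ {p q} → p ∈ side-c → q ∈ side-d → ¬ HAdj p q
    cross-independent {p} {q} p∈ q∈ p~q = proj₂ (in-side-d q∈)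
      (sym (common-neighbours c~d (proj₁ (in-side-c p∈)) (HAdj-sym {c = d} {q} (proj₁ (in-side-d q∈)))
                              (HAdj-sym {c = p} {q} p~q) (≢-sym (proj₂ (in-side-c p∈)))))

    AB-independent : ∀ {p q} → p ∈ AB → q ∈ AB → ¬ HAdj p q
    AB-independent {p} {q} p∈ q∈ p~q with ∈-++⁻ side-c p∈ | ∈-++⁻ side-c q∈
    ... | inj₁ p∈c | inj₁ q∈c = no-triangle (proj₁ (in-side-c p∈c)) (proj₁ (in-side-c q∈c)) p~q
    ... | inj₂ p∈d | inj₂ q∈d = no-triangle (proj₁ (in-side-d p∈d)) (proj₁ (in-side-d q∈d)) p~q
    ... | inj₁ p∈c | inj₂ q∈d = cross-independent p∈c q∈d p~q
    ... | inj₂ p∈d | inj₁ q∈c = cross-independent q∈c p∈d (HAdj-sym {c = p} {q} p~q)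

  -- An isolated edge c — d would leave the 2K classes of EdgeNeighbours
  -- dead, contradicting the counting lemma when |F| ≤ K and K ≥ 1.
  no-isolated : 1 ≤ K → length F ≤ K → ∀ c → ¬ Isolated configFor c
  no-isolated 1≤K |F|≤K c (d , c~d , _ , dead-c , dead-d) =
    <⇒≱ (m<m+n K 1≤K) (≤-trans (≤-trans length-AB (Independent.bound AB-unique AB-dead AB-independent)) |F|≤K)
    where
    open EdgeNeighbours c~d
    AB-dead : ∀ {p} → p ∈ AB → DeadFor p
    AB-dead {p} p∈ with ∈-++⁻ side-c p∈
    ... | inj₁ p∈c = dead-sound p (dead-c p (proj₁ (in-side-c p∈c)) (proj₂ (in-side-c p∈c)))
    ... | inj₂ p∈d = dead-sound p (dead-d p (proj₁ (in-side-d p∈d)) (proj₂ (in-side-d p∈d)))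

-- The
-- configuration left in H_(k+1) is bounded and has no isolated edge, so all
-- alive classes are connected; walks of classes lift to BH_n - V(F), and
-- at least two vertices survive since 4|F| + 2 ≤ 4^n.
module LowerBound (k : ℕ) (F : List (C4 (suc (suc k)))) (|F|≤ : length F ≤ suc k) where
  open Vertices {suc k}
  open CutConfig F

  alive-class : ∀ u → ¬ InV u F → Alive configFor (classOf u)
  alive-class u u∉ dead with dead-sound (classOf u) dead | twin-cases u
  ... | in₀ , _ | inj₁ e = u∉ (subst (λ z → InV z F) (sym e) in₀)
  ... | _ , in₁ | inj₂ e = u∉ (subst (λ z → InV z F) (sym e) in₁)

  alive-twin : ∀ c → Alive configFor c → ∃[ z ] classOf z ≡ c × ¬ InV z F
  alive-twin c alive with InV? (twin₀ c) F | InV? (twin₁ c) F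
  ... | no ∉₀ | _ = twin₀ c , classOf-twin₀ c , ∉₀
  ... | yes _ | no ∉₁ = twin₁ c , classOf-twin₁ c , ∉₁
  ... | yes in₀ | yes in₁ = ⊥-elim (alive (dead-complete c (in₀ , in₁)))

  lift-walk : ∀ {c₁ c₂} → Walk configFor c₁ c₂ → ∀ u → classOf u ≡ c₁ → ¬ InV u F →
              ∃[ w ] classOf w ≡ c₂ × ¬ InV w F × Reach F u w
  lift-walk (start _) u refl u∉ = u , refl , u∉ , here u∉
  lift-walk (step p h alive) u u∈ u∉ with lift-walk p u u∈ u∉ | alive-twin _ alive
  ... | w , refl , w∉ , r | z , refl , z∉ = z , refl , z∉ , step r (classOf-adj w z h) z∉

  -- Every alive class has an alive neighbour, since at most k+1 < k+2
  -- classes of the opposite parity are dead.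
  alive-neighbour : ∀ c → Alive configFor c → ¬ ¬ (∃[ d ] HAdj c d × Alive configFor d)
  alive-neighbour c _ none = <⇒≱ (s≤s ≤-refl)
    (≤-trans (all-neighbours-dead c (λ d h → not-alive configFor d (λ alive → none (d , h , alive))))
             (bounded-opposite (bounded |F|≤) c))

  reach : ∀ u v → ¬ InV u F → ¬ InV v F → ¬ ¬ Reach F u v
  reach u v u∉ v∉ =
    proj₁ (core k) configFor (bounded |F|≤) (classOf u) (classOf v) (alive-class u u∉) (alive-class v v∉)
      (no-isolated (s≤s z≤n) |F|≤ (classOf u)) (no-isolated (s≤s z≤n) |F|≤ (classOf v)) >>= λ p →
    alive-neighbour (classOf v) (alive-class v v∉) >>= λ { (d , h , alive-d) →
    let (w , w∈ , w∉ , r) = lift-walk p u refl u∉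
        (z , z∈ , z∉) = alive-twin d alive-d
    in pure (step (step r (classOf-adj w z (subst₂ HAdj (sym w∈) (sym z∈) h)) z∉)
                  (classOf-adj z v (HAdj-sym {c = classOf v} {classOf z} (subst (HAdj (classOf v)) (sym z∈) h))) v∉) }

  verticesOf : List V
  verticesOf = concatMap (λ q → C4.v0 q ∷ C4.v1 q ∷ C4.v2 q ∷ C4.v3 q ∷ []) F

  ∈-verticesOf : ∀ {x} → InV x F → x ∈ verticesOf
  ∈-verticesOf {x} x∈F = ∈-concatMap⁺ (λ q → C4.v0 q ∷ C4.v1 q ∷ C4.v2 q ∷ C4.v3 q ∷ []) (Any.map (λ {q} → on-cycle {q}) x∈F)
    where
    on-cycle : ∀ {q} → InC4 x q → x ∈ C4.v0 q ∷ C4.v1 q ∷ C4.v2 q ∷ C4.v3 q ∷ []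
    on-cycle (inj₁ e) = here e
    on-cycle (inj₂ (inj₁ e)) = there (here e)
    on-cycle (inj₂ (inj₂ (inj₁ e))) = there (there (here e))
    on-cycle (inj₂ (inj₂ (inj₂ e))) = there (there (there (here e)))

  length-verticesOf : length verticesOf ≡ 4 * length F
  length-verticesOf = length-concatMap-4 F
    where
    length-concatMap-4 : ∀ (G : List (C4 (suc (suc k)))) →
      length (concatMap (λ q → C4.v0 q ∷ C4.v1 q ∷ C4.v2 q ∷ C4.v3 q ∷ []) G) ≡ 4 * length G
    length-concatMap-4 [] = refl
    length-concatMap-4 (q ∷ G) = trans (cong (4 +_) (length-concatMap-4 G)) (sym (*-suc 4 (length G)))

  few-vertices : 2 + length verticesOf ≤ 4 ^ suc (suc k)
  few-vertices = begin
    2 + length verticesOf     ≡⟨ cong (2 +_) length-verticesOf ⟩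
    2 + 4 * length F          ≤⟨ +-monoʳ-≤ 2 (*-monoʳ-≤ 4 |F|≤) ⟩
    2 + 4 * suc k             ≤⟨ ≤-by (8 * k + 10) (expand k) ⟩
    4 * (3 * suc k + 1)       ≤⟨ *-monoʳ-≤ 4 (3k+1≤4^k (suc k)) ⟩
    4 ^ suc (suc k)           ∎
    where
    open ≤-Reasoning
    expand : ∀ k → 4 * (3 * suc k + 1) ≡ (2 + 4 * suc k) + (8 * k + 10)
    expand = solve-∀

  two-survive : ¬ ¬ (∃[ v₁ ] ∃[ v₂ ] ¬ InV v₁ F × ¬ InV v₂ F × v₁ ≢ v₂)
  two-survive =
    tail-avoid verticesOf (≤-trans (n≤1+n _) few-vertices) >>= λ { (v₁ , v₁∉) →
    tail-avoid (v₁ ∷ verticesOf) few-vertices >>= λ { (v₂ , v₂∉) →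
    pure (v₁ , v₂ , (λ v₁∈ → v₁∉ (∈-verticesOf v₁∈)) , (λ v₂∈ → v₂∉ (there (∈-verticesOf v₂∈))) ,
          λ e → v₂∉ (here (sym e))) } }

  not-cut : ¬ IsSubgraphCut F
  not-cut (inj₁ (u , v , u∉ , v∉ , ¬reach)) = reach u v u∉ v∉ ¬reach
  not-cut (inj₂ trivial) = two-survive λ { (v₁ , v₂ , v₁∉ , v₂∉ , v₁≢v₂) → v₁≢v₂ (trivial v₁ v₂ v₁∉ v₂∉) }

lower-bound : ∀ k (F : List (C4 (suc (suc k)))) → IsSubgraphCut F → suc (suc k) ≤ length F
lower-bound k F cut with suc (suc k) ≤? length F
... | yes n≤|F| = n≤|F|
... | no n≰|F| = ⊥-elim (LowerBound.not-cut k F (≤-pred (≰⇒> n≰|F|)) cut)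

-- Upper bound: n = k+2 4-cycles isolate the vertex u = (0, Z), Z = 0…0.
-- For each move a the 4-cycle (1, Z+a) — (2, Z) — (3, Z+a) — (0, w a)
-- contains both neighbours (1, Z+a), (3, Z+a) of u; here w a ≠ Z is a
-- tail adjacent to Z+a.  The vertex (2, Z + e₀) survives as well.
module UpperBound (k : ℕ) where
  open Vertices {suc k}

  Z : Tail (suc k)
  Z = replicate (suc k) zero

  target partner : Move (suc k) → Tail (suc k)
  target a = shift a Z
  partner nothing = unshift (just zero) Z
  partner (just i) = shift (just i) Z

  partner▹target : ∀ a → partner a ▹ target a
  partner▹target nothing = unshift▹ (just zero) Z
  partner▹target (just i) = inj₁ refl

  partner≢Z : ∀ a → partner a ≢ Z
  partner≢Z nothing e = dec≢id zero (cong (λ t → lookup t zero) e)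
  partner≢Z (just i) e =
    inc≢id (lookup Z i) (trans (sym (bump-here i _)) (trans (sym (lookup-shift (just i) Z i)) (cong (λ t → lookup t i) e)))

  cycleAt : Move (suc k) → C4 (suc (suc k))
  cycleAt a = record
    { v0 = suc zero ∷ target a
    ; v1 = suc (suc zero) ∷ Z
    ; v2 = suc (suc (suc zero)) ∷ target a
    ; v3 = zero ∷ partner a
    ; e01 = classOf-adj (suc zero ∷ target a) (suc (suc zero) ∷ Z) (shift▹ a Z)
    ; e12 = classOf-adj (suc (suc zero) ∷ Z) (suc (suc (suc zero)) ∷ target a) (shift▹ a Z)
    ; e23 = classOf-adj (suc (suc (suc zero)) ∷ target a) (zero ∷ partner a) (partner▹target a)
    ; e30 = classOf-adj (zero ∷ partner a) (suc zero ∷ target a) (partner▹target a)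
    ; d01 = λ () ; d02 = λ () ; d03 = λ () ; d12 = λ () ; d13 = λ () ; d23 = λ ()
    }

  F : List (C4 (suc (suc k)))
  F = map cycleAt (moves (suc k))

  length-F : length F ≡ suc (suc k)
  length-F = trans (length-map cycleAt (moves (suc k))) (length-moves (suc k))

  u v : V
  u = zero ∷ Z
  v = suc (suc zero) ∷ shift (just zero) Z

  on-some-cycle : ∀ {x} → Any (InC4 x) F → ∃[ a ] InC4 x (cycleAt a)
  on-some-cycle x∈ with find x∈
  ... | q , q∈ , x∈q with ∈-map⁻ cycleAt q∈
  ...   | a , _ , refl = a , x∈q

  neighbours-in-F : ∀ w → Adj u w → InV w F
  neighbours-in-F (b ∷ bs) (b≡ , h) with ▹⇒shift h | b≡
  ... | a , refl | inj₁ refl = lose (∈-map⁺ cycleAt (moves-complete a)) (inj₁ refl)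
  ... | a , refl | inj₂ refl = lose (∈-map⁺ cycleAt (moves-complete a)) (inj₂ (inj₂ (inj₁ refl)))

  u∉F : ¬ InV u F
  u∉F u∈ with on-some-cycle u∈
  ... | a , inj₂ (inj₂ (inj₂ e)) = partner≢Z a (sym (Vecₚ.∷-injectiveʳ e))

  v∉F : ¬ InV v F
  v∉F v∈ with on-some-cycle v∈
  ... | a , inj₂ (inj₁ ())
  ... | a , inj₂ (inj₂ (inj₁ ()))
  ... | a , inj₂ (inj₂ (inj₂ ()))
  ... | a , inj₁ ()

  stuck : ∀ {w} → Reach F u w → w ≡ u
  stuck (here _) = refl
  stuck (step r h w∉) with stuck r
  ... | refl = ⊥-elim (w∉ (neighbours-in-F _ h))

  cut : IsSubgraphCut F
  cut = inj₁ (u , v , u∉F , v∉F , λ r → case-absurd (stuck r))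
    where
    case-absurd : v ≢ u
    case-absurd ()

theorem7 : ∀ (n : ℕ) → 2 ≤ n → KappaC4 n n
theorem7 (suc (suc k)) _ = (UpperBound.F k , UpperBound.length-F k , UpperBound.cut k) , lower-bound k
theorem7 (suc zero) (s≤s ())
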